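{- Let $r>1$ and $k\ge\ell\ge4$ be integers. For any graph $G$, \begin{align*} m_e(G\square H_{k,\ell},r)&\le m_e(G,r)+(k+\ell-5)\,m_e(G,r-1)+2\,m_e(G,r-2)+d^G_{r-1}\\ &\quad+(k+\ell-3)\,d^G_{r-2}+(k+\ell-1)\sum_{t=0}^{r-3}d^G_t. \end{align*}
   Context: All graphs are finite and simple; $\square$ is the Cartesian product. For integers $k\ge\ell\ge3$, the theta graph $H_{k,\ell}$ is obtained by joining two vertices by three internally vertex-disjoint paths of lengths $1$, $\ell-1$ and $k-1$. For a graph $G$ and integer $r\ge0$, the $r$-bond bootstrap percolation process on $G$ starts from a set $S\subseteq E(G)$ of infected edges; at each step a healthy edge becomes infected if at least one of its endpoints is incident with at least $r$ infected edges, and infected edges stay infected. $S$ is $r$-percolating if it eventually infects all of $E(G)$; $m_e(G,r)$ is the minimum size of an $r$-percolating set. $d^G_t$ is the number of vertices of $G$ of degree $t$. -}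

module Defs where

open import Data.Nat using (ℕ; zero; suc; _+_; _*_; _∸_; _≤_; _≡ᵇ_; _<ᵇ_)
open import Data.Bool using (Bool; true; false; _∧_; _∨_; not; if_then_else_)
open import Data.Fin using (Fin; toℕ; remQuot) renaming (zero to fzero; suc to fsuc)
open import Data.Bool.Properties using (∨-comm)
open import Relation.Nullary.Decidable using (dec-true)
open import Relation.Binary.PropositionalEquality using (refl; cong; cong₂) renaming (sym to ≡sym)
open import Relation.Nullary using (yes; no)
open import Data.Fin.Properties using (_≟_)
open import Data.Product using (Σ; _×_; _,_; proj₁; proj₂)
open import Relation.Nullary.Decidable using (⌊_⌋)
open import Relation.Binary.PropositionalEquality using (_≡_)
open import Function using (_∘_)

sumFin : (n : ℕ) → (Fin n → ℕ) → ℕ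
sumFin zero    f = 0
sumFin (suc n) f = f fzero + sumFin n (f ∘ fsuc)

sumBelow : ℕ → (ℕ → ℕ) → ℕ
sumBelow zero    f = 0
sumBelow (suc n) f = sumBelow n f + f n

record Graph : Set where
  field
    n      : ℕ
    adj    : Fin n → Fin n → Bool
    sym    : ∀ i j → adj i j ≡ adj j i
    irrefl : ∀ i → adj i i ≡ false
open Graph public

eqF : ∀ {n} → Fin n → Fin n → Bool
eqF i j = ⌊ i ≟ j ⌋

simpleAdj : ∀ {n} → (Fin n → Fin n → Bool) → Fin n → Fin n → Bool
simpleAdj raw i j = not (eqF i j) ∧ (raw i j ∨ raw j i)

eqF-sym : ∀ {n} (i j : Fin n) → eqF i j ≡ eqF j i
eqF-sym i j with i ≟ j | j ≟ i
... | yes _ | yes _ = refl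
... | no _  | no _  = refl
... | yes p | no q  with q (≡sym p)
... | ()
eqF-sym i j | no q | yes p with q (≡sym p)
... | ()

eqF-refl : ∀ {n} (i : Fin n) → eqF i i ≡ true
eqF-refl i with i ≟ i
... | yes _ = refl
... | no q with q refl
... | ()

mkGraph : (m : ℕ) → (Fin m → Fin m → Bool) → Graph
mkGraph m raw = record
  { n = m
  ; adj = simpleAdj raw
  ; sym = λ i j → cong₂ _∧_ (cong not (eqF-sym i j)) (∨-comm (raw i j) (raw j i))
  ; irrefl = λ i → cong (λ b → not b ∧ (raw i i ∨ raw i i)) (eqF-refl i)
  }

_□adj_ : (G H : Graph) → Fin (n G * n H) → Fin (n G * n H) → Bool
(G □adj H) x y with remQuot (n H) x | remQuot (n H) y
... | (g₁ , h₁) | (g₂ , h₂) =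
  (eqF g₁ g₂ ∧ adj H h₁ h₂) ∨ (eqF h₁ h₂ ∧ adj G g₁ g₂)

-- Theta graph H_{k,ℓ} on vertices 0,…,N-1 with N = k+ℓ-2: the cycle
-- 0-1-…-(N-1)-0 plus the chord {0, ℓ-1}. The paths between 0 and ℓ-1 are:
-- the chord (length 1), 0-1-…-(ℓ-1) (length ℓ-1), and
-- (ℓ-1)-ℓ-…-(N-1)-0 (length N-(ℓ-1) = k-1).
thetaRaw : (k ℓ : ℕ) → Fin (k + ℓ ∸ 2) → Fin (k + ℓ ∸ 2) → Bool
thetaRaw k ℓ i j =
  (suc (toℕ i) ≡ᵇ toℕ j)
  ∨ ((toℕ i ≡ᵇ 0) ∧ (toℕ j ≡ᵇ (k + ℓ ∸ 2) ∸ 1))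
  ∨ ((toℕ i ≡ᵇ 0) ∧ (toℕ j ≡ᵇ ℓ ∸ 1))

record EdgeSet (G : Graph) : Set where
  field
    mem    : Fin (n G) → Fin (n G) → Bool
    memSym : ∀ i j → mem i j ≡ mem j i
    sub    : ∀ i j → mem i j ≡ true → adj G i j ≡ true
open EdgeSet public

b2n : Bool → ℕ
b2n true  = 1
b2n false = 0

size : {G : Graph} → EdgeSet G → ℕ
size {G} S = sumFin (n G) λ i → sumFin (n G) λ j →
  b2n ((toℕ i <ᵇ toℕ j) ∧ mem S i j)

degIn : ∀ {m} → (Fin m → Fin m → Bool) → Fin m → ℕ
degIn {m} f u = sumFin m λ v → b2n (f u v)

dcount : Graph → ℕ → ℕ
dcount G t = sumFin (n G) λ u → b2n (degIn (adj G) u ≡ᵇ t)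

step : (G : Graph) → ℕ → (Fin (n G) → Fin (n G) → Bool) → Fin (n G) → Fin (n G) → Bool
step G r f u v =
  f u v ∨ (adj G u v ∧ (not (degIn f u <ᵇ r) ∨ not (degIn f v <ᵇ r)))

iter : (G : Graph) → ℕ → ℕ → (Fin (n G) → Fin (n G) → Bool) → Fin (n G) → Fin (n G) → Bool
iter G r zero    f = f
iter G r (suc t) f = step G r (iter G r t f)

Percolating : (G : Graph) → ℕ → EdgeSet G → Set
Percolating G r S = Σ ℕ λ t → ∀ u v → adj G u v ≡ true → iter G r t (mem S) u v ≡ true

IsMe : Graph → ℕ → ℕ → Set
IsMe G r m =
  (Σ (EdgeSet G) λ S → Percolating G r S × size S ≡ m)
  × (∀ (S : EdgeSet G) → Percolating G r S → m ≤ size S)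

-- The Cartesian product graph (the relation is already symmetric and
-- loopless, so simpleAdj leaves it unchanged).
_□_ : Graph → Graph → Graph
G □ H = mkGraph (n G * n H) (G □adj H)

-- The theta graph H_{k,ℓ} (intended for k ≥ ℓ ≥ 3).
theta : ℕ → ℕ → Graph
theta k ℓ = mkGraph (k + ℓ ∸ 2) (thetaRaw k ℓ)

module Submission where

-- Write r = r′ + 2 and number the vertices of H = H_{k,ℓ} as the cycle
-- 0, 1, …, M + 1 (M = k + ℓ − 4) with chord {0, L}, L = ℓ − 1.  Take
-- minimum percolating sets A, B, C of G for the thresholds r, r − 1, r − 2
-- and infect, in G □ H, a copy of A on the layer G × {0}, copies of C on the
-- layers G × {1} and G × {M + 1}, and copies of B on all other layers; in
-- the fibre {g} × H infect the edge {0, 1} if deg g = r − 1, the path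
-- 0, 1, …, M + 1 if deg g = r − 2, all of H if deg g < r − 2, and nothing
-- otherwise.
--
-- The layer at 0 fills up.  Once a layer is full, every vertex (g, h) with
-- deg g ≥ r − 1 has r − 1 infected layer edges and one infected fibre edge,
-- so it infects all its fibre edges; this hands each neighbouring B-layer
-- the one extra edge per vertex that threshold r − 1 needs, and the filling
-- spreads along the chord to L and along the path to 2, …, M.  The C-layers
-- 1 and M + 1 then get two extra edges per vertex from their two full
-- neighbours (or from the seeded path when deg g = r − 2), and once every
-- layer is full every fibre fills up as well.
--
-- Percolation is established through closed edge sets: since the process
-- stabilises after finitely many steps, a set percolates as soon as every
-- closed edge set containing it contains all edges.  The minimum m_e exists
-- by an exhaustive search over edge sets.

open import Defs hiding (sym)
open import Data.Nat using (ℕ; zero; suc; _+_; _*_; _∸_; _≤_; _<_; z≤n; s≤s; s≤s⁻¹; _≡ᵇ_; _<ᵇ_)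
open import Data.Nat.Properties
open import Data.Bool using (Bool; true; false; _∧_; _∨_; not; if_then_else_)
open import Data.Fin using (Fin; toℕ; combine; remQuot; fromℕ<; _↑ˡ_; _↑ʳ_) renaming (zero to fzero; suc to fsuc)
open import Data.Product using (Σ; _×_; _,_; proj₁; proj₂; uncurry)
open import Data.Fin.Subset using (Subset)
open import Data.Fin.Subset.Properties using (anySubset?)
open import Data.Vec using (lookup; tabulate)
open import Data.Vec.Properties using (lookup∘tabulate)
open import Data.Sum using (_⊎_; inj₁; inj₂; [_,_]′)
open import Data.Empty using (⊥-elim)
open import Relation.Nullary using (¬_; Dec; does; yes; no)
open import Relation.Nullary.Decidable using (dec-true; dec-false; does-⇔; isYes≗does; _×-dec_; _→-dec_)
open import Function.Bundles using (mk⇔)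
import Data.Fin.Properties as Fin
import Data.Bool.Properties as Bool
open import Relation.Binary.PropositionalEquality
open import Function using (_∘_)
open import Data.Nat.Solver using (module +-*-Solver)
open import Relation.Binary using (tri<; tri≈; tri>)
open import Algebra.Properties.CommutativeSemigroup +-commutativeSemigroup using (interchange)

does⇒ : ∀ {p} {P : Set p} (p? : Dec P) → does p? ≡ true → P
does⇒ (yes p) _ = p
does⇒ (no _) ()

not<ᵇ⇒≥ : ∀ m n → not (m <ᵇ n) ≡ true → n ≤ m
not<ᵇ⇒≥ m zero _ = z≤n
not<ᵇ⇒≥ zero (suc n) ()
not<ᵇ⇒≥ (suc m) (suc n) e = s≤s (not<ᵇ⇒≥ m n e)

≥⇒not<ᵇ : ∀ {m n} → n ≤ m → not (m <ᵇ n) ≡ true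
≥⇒not<ᵇ {m} {n} n≤m = cong not (dec-false (m <? n) (≤⇒≯ n≤m))

≡ᵇ-refl : ∀ n → (n ≡ᵇ n) ≡ true
≡ᵇ-refl n = dec-true (n ≟ n) refl

≡ᵇ-≢ : ∀ {m n} → m ≢ n → (m ≡ᵇ n) ≡ false
≡ᵇ-≢ {m} {n} = dec-false (m ≟ n)

<ᵇ-< : ∀ {m n} → m < n → (m <ᵇ n) ≡ true
<ᵇ-< {m} {n} = dec-true (m <? n)

<ᵇ-≮ : ∀ {m n} → ¬ m < n → (m <ᵇ n) ≡ false
<ᵇ-≮ {m} {n} = dec-false (m <? n)

∧-true : ∀ {b c} → (b ∧ c) ≡ true → b ≡ true × c ≡ true
∧-true {true} e = refl , e

∧-intro : ∀ {b c} → b ≡ true → c ≡ true → (b ∧ c) ≡ true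
∧-intro refl refl = refl

∨-true : ∀ {b c} → (b ∨ c) ≡ true → b ≡ true ⊎ c ≡ true
∨-true {true} _ = inj₁ refl
∨-true {false} e = inj₂ e

∨-introˡ : ∀ {b} c → b ≡ true → (b ∨ c) ≡ true
∨-introˡ c refl = refl

∨-introʳ : ∀ b {c} → c ≡ true → (b ∨ c) ≡ true
∨-introʳ true _ = refl
∨-introʳ false e = e

b2n≤1 : ∀ b → b2n b ≤ 1
b2n≤1 true = s≤s z≤n
b2n≤1 false = z≤n

b2n-true : ∀ {b} → b ≡ true → b2n b ≡ 1
b2n-true refl = refl

b2n-mono : ∀ {b c} → (b ≡ true → c ≡ true) → b2n b ≤ b2n c
b2n-mono {false} _ = z≤n
b2n-mono {true} f rewrite f refl = ≤-refl

b2n-∨ : ∀ b c → b2n (b ∨ c) ≤ b2n b + b2n c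
b2n-∨ true _ = s≤s z≤n
b2n-∨ false _ = ≤-refl

b2n-∧ : ∀ b c → b2n (b ∧ c) ≡ b2n b * b2n c
b2n-∧ true c = sym (+-identityʳ (b2n c))
b2n-∧ false _ = refl

b2n-∧-∨ : ∀ c a b → b2n (c ∧ (a ∨ b)) ≤ b2n (c ∧ a) + b2n (c ∧ b)
b2n-∧-∨ c a b = subst (_≤ b2n (c ∧ a) + b2n (c ∧ b)) (cong b2n (sym (Bool.∧-distribˡ-∨ c a b))) (b2n-∨ (c ∧ a) _)

b2n-∧-guarded : ∀ c e {c′} x → (e ≡ true → c ≡ true → c′ ≡ true) → b2n (c ∧ (e ∧ x)) ≤ b2n e * b2n (c′ ∧ x)
b2n-∧-guarded c false x _ = b2n-mono (proj₂ ∘ ∧-true {c})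
b2n-∧-guarded c true x c⇒c′ =
  ≤-trans (b2n-mono λ e → ∧-intro (c⇒c′ refl (proj₁ (∧-true e))) (proj₂ (∧-true e))) (≤-reflexive (sym (+-identityʳ _)))

sumFin-cong : ∀ n {f g : Fin n → ℕ} → (∀ i → f i ≡ g i) → sumFin n f ≡ sumFin n g
sumFin-cong zero _ = refl
sumFin-cong (suc n) e = cong₂ _+_ (e fzero) (sumFin-cong n (e ∘ fsuc))

sumFin-mono : ∀ n {f g : Fin n → ℕ} → (∀ i → f i ≤ g i) → sumFin n f ≤ sumFin n g
sumFin-mono zero _ = z≤n
sumFin-mono (suc n) le = +-mono-≤ (le fzero) (sumFin-mono n (le ∘ fsuc))

sumFin-zero : ∀ n → sumFin n (λ _ → 0) ≡ 0
sumFin-zero zero = refl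
sumFin-zero (suc n) = sumFin-zero n

sumFin-+ : ∀ n (f g : Fin n → ℕ) → sumFin n (λ i → f i + g i) ≡ sumFin n f + sumFin n g
sumFin-+ zero _ _ = refl
sumFin-+ (suc n) f g =
  trans (cong (f fzero + g fzero +_) (sumFin-+ n (f ∘ fsuc) (g ∘ fsuc)))
        (interchange (f fzero) (g fzero) _ _)

sumFin-*ˡ : ∀ n c (f : Fin n → ℕ) → sumFin n (λ i → c * f i) ≡ c * sumFin n f
sumFin-*ˡ zero c _ = sym (*-zeroʳ c)
sumFin-*ˡ (suc n) c f =
  trans (cong (c * f fzero +_) (sumFin-*ˡ n c (f ∘ fsuc))) (sym (*-distribˡ-+ c (f fzero) _))

sumFin-*ʳ : ∀ n c (f : Fin n → ℕ) → sumFin n (λ i → f i * c) ≡ sumFin n f * c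
sumFin-*ʳ n c f = trans (sumFin-cong n (λ i → *-comm (f i) c)) (trans (sumFin-*ˡ n c f) (*-comm c _))

term≤sumFin : ∀ n (f : Fin n → ℕ) i → f i ≤ sumFin n f
term≤sumFin (suc n) f fzero = m≤m+n _ _
term≤sumFin (suc n) f (fsuc i) = ≤-trans (term≤sumFin n (f ∘ fsuc) i) (m≤n+m _ _)

two-terms≤sumFin : ∀ n (f : Fin n → ℕ) {i j} → i ≢ j → f i + f j ≤ sumFin n f
two-terms≤sumFin (suc n) f {fzero} {fzero} i≢j = ⊥-elim (i≢j refl)
two-terms≤sumFin (suc n) f {fzero} {fsuc j} _ = +-monoʳ-≤ (f fzero) (term≤sumFin n (f ∘ fsuc) j)
two-terms≤sumFin (suc n) f {fsuc i} {fzero} _ =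
  subst (_≤ sumFin (suc n) f) (+-comm (f fzero) (f (fsuc i)))
        (+-monoʳ-≤ (f fzero) (term≤sumFin n (f ∘ fsuc) i))
two-terms≤sumFin (suc n) f {fsuc i} {fsuc j} i≢j =
  ≤-trans (two-terms≤sumFin n (f ∘ fsuc) (i≢j ∘ cong fsuc)) (m≤n+m _ _)

sumFin-mono-< : ∀ n {f g : Fin n → ℕ} → (∀ i → f i ≤ g i) → ∀ i → f i < g i → sumFin n f < sumFin n g
sumFin-mono-< (suc n) le fzero lt = +-mono-<-≤ lt (sumFin-mono n (le ∘ fsuc))
sumFin-mono-< (suc n) le (fsuc i) lt = +-mono-≤-< (le fzero) (sumFin-mono-< n (le ∘ fsuc) i lt)

sumFin≤n*c : ∀ n c (f : Fin n → ℕ) → (∀ i → f i ≤ c) → sumFin n f ≤ n * c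
sumFin≤n*c zero _ _ _ = z≤n
sumFin≤n*c (suc n) c f le = +-mono-≤ (le fzero) (sumFin≤n*c n c (f ∘ fsuc) (le ∘ fsuc))

sumFin-++ : ∀ a b (f : Fin (a + b) → ℕ) →
            sumFin (a + b) f ≡ sumFin a (λ i → f (i ↑ˡ b)) + sumFin b (λ j → f (a ↑ʳ j))
sumFin-++ zero _ _ = refl
sumFin-++ (suc a) b f = trans (cong (f fzero +_) (sumFin-++ a b (f ∘ fsuc))) (sym (+-assoc (f fzero) _ _))

sumFin-combine : ∀ m n (f : Fin (m * n) → ℕ) →
                 sumFin (m * n) f ≡ sumFin m (λ i → sumFin n (λ j → f (combine i j)))
sumFin-combine zero _ _ = refl
sumFin-combine (suc m) n f =
  trans (sumFin-++ n (m * n) f) (cong (sumFin n (λ j → f (j ↑ˡ (m * n))) +_) (sumFin-combine m n (λ x → f (n ↑ʳ x))))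

sumFin-swap : ∀ m n (f : Fin m → Fin n → ℕ) →
              sumFin m (λ i → sumFin n (f i)) ≡ sumFin n (λ j → sumFin m (λ i → f i j))
sumFin-swap zero n _ = sym (sumFin-zero n)
sumFin-swap (suc m) n f =
  trans (cong (sumFin n (f fzero) +_) (sumFin-swap m n (f ∘ fsuc)))
        (sym (sumFin-+ n (f fzero) (λ j → sumFin m (λ i → f (fsuc i) j))))

sumBelow-suc : ∀ n f → sumBelow (suc n) f ≡ f 0 + sumBelow n (f ∘ suc)
sumBelow-suc zero f = +-comm 0 (f 0)
sumBelow-suc (suc n) f = trans (cong (_+ f (suc n)) (sumBelow-suc n f)) (+-assoc (f 0) _ _)

sumFin-toℕ : ∀ n (f : ℕ → ℕ) → sumFin n (f ∘ toℕ) ≡ sumBelow n f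
sumFin-toℕ zero _ = refl
sumFin-toℕ (suc n) f = trans (cong (f 0 +_) (sumFin-toℕ n (f ∘ suc))) (sym (sumBelow-suc n f))

sumBelow-mono : ∀ n {f g : ℕ → ℕ} → (∀ i → i < n → f i ≤ g i) → sumBelow n f ≤ sumBelow n g
sumBelow-mono zero _ = z≤n
sumBelow-mono (suc n) le = +-mono-≤ (sumBelow-mono n (λ i i<n → le i (m<n⇒m<1+n i<n))) (le n ≤-refl)

sumBelow-const : ∀ n c → sumBelow n (λ _ → c) ≡ n * c
sumBelow-const zero _ = refl
sumBelow-const (suc n) c = trans (cong (_+ c) (sumBelow-const n c)) (+-comm (n * c) c)

sumBelow-hit : ∀ {d n} → d < n → 1 ≤ sumBelow n (λ t → b2n (d ≡ᵇ t))
sumBelow-hit {d} {suc n} d<1+n with d ≟ n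
... | yes refl rewrite ≡ᵇ-refl d = m≤n+m 1 _
... | no d≢n = ≤-trans (sumBelow-hit (≤∧≢⇒< (s≤s⁻¹ d<1+n) d≢n)) (m≤m+n _ _)

sumFin-sumBelow : ∀ m n (f : Fin m → ℕ → ℕ) →
                  sumFin m (λ i → sumBelow n (f i)) ≡ sumBelow n (λ t → sumFin m (λ i → f i t))
sumFin-sumBelow m zero _ = sumFin-zero m
sumFin-sumBelow m (suc n) f =
  trans (sumFin-+ m (λ i → sumBelow n (f i)) (λ i → f i n)) (cong (_+ sumFin m (λ i → f i n)) (sumFin-sumBelow m n f))

sumFin-toℕ≡ᵇ≤1 : ∀ n c → sumFin n (λ i → b2n (toℕ i ≡ᵇ c)) ≤ 1
sumFin-toℕ≡ᵇ≤1 zero _ = z≤n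
sumFin-toℕ≡ᵇ≤1 (suc n) zero = ≤-reflexive (cong suc (sumFin-zero n))
sumFin-toℕ≡ᵇ≤1 (suc n) (suc c) = sumFin-toℕ≡ᵇ≤1 n c

eqF≡toℕ≡ᵇ : ∀ {n} (i j : Fin n) → eqF i j ≡ (toℕ j ≡ᵇ toℕ i)
eqF≡toℕ≡ᵇ i j =
  trans (isYes≗does (i Fin.≟ j)) (does-⇔ (mk⇔ (sym ∘ cong toℕ) (Fin.toℕ-injective ∘ sym)) (i Fin.≟ j) (toℕ j ≟ toℕ i))

sumFin-eqF≤1 : ∀ {n} (i : Fin n) → sumFin n (λ j → b2n (eqF i j)) ≤ 1
sumFin-eqF≤1 {n} i =
  subst (_≤ 1) (sumFin-cong n (λ j → cong b2n (sym (eqF≡toℕ≡ᵇ i j)))) (sumFin-toℕ≡ᵇ≤1 n (toℕ i))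

eqF⇒≡ : ∀ {n} (i j : Fin n) → eqF i j ≡ true → i ≡ j
eqF⇒≡ i j e with i Fin.≟ j
... | yes i≡j = i≡j

eqF-≢ : ∀ {n} {i j : Fin n} → i ≢ j → eqF i j ≡ false
eqF-≢ {i = i} {j} i≢j with i Fin.≟ j
... | yes i≡j = ⊥-elim (i≢j i≡j)
... | no _ = refl

eqF-∧-sym : ∀ {n} (i j : Fin n) {x y} → (i ≡ j → x ≡ y) → (eqF i j ∧ x) ≡ (eqF j i ∧ y)
eqF-∧-sym i j x≡y rewrite eqF-sym i j with eqF j i in e
... | false = refl
... | true = x≡y (sym (eqF⇒≡ j i e))

sumFin-eqF*≤ : ∀ {m} (i : Fin m) c → sumFin m (λ j → b2n (eqF i j) * c) ≤ c
sumFin-eqF*≤ {m} i c =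
  ≤-trans (≤-reflexive (sumFin-*ʳ m c (b2n ∘ eqF i))) (≤-trans (*-monoˡ-≤ c (sumFin-eqF≤1 i)) (≤-reflexive (+-identityʳ c)))

module Counting (m : ℕ) where

  pairCount : (Fin m → Fin m → Bool) → ℕ
  pairCount R = sumFin m λ u → sumFin m λ v → b2n (R u v)

  relSize : (Fin m → Fin m → Bool) → ℕ
  relSize R = sumFin m λ u → sumFin m λ v → b2n ((toℕ u <ᵇ toℕ v) ∧ R u v)

  pairCount≤ : ∀ R → pairCount R ≤ m * (m * 1)
  pairCount≤ R = sumFin≤n*c m _ _ λ u → sumFin≤n*c m 1 _ λ v → b2n≤1 (R u v)

  pairCount-mono-< : ∀ {R R′} → (∀ u v → R u v ≡ true → R′ u v ≡ true) →
                     ∀ u v → R u v ≡ false → R′ u v ≡ true → pairCount R < pairCount R′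
  pairCount-mono-< R⊆R′ u v Ruv R′uv =
    sumFin-mono-< m (λ u′ → sumFin-mono m λ v′ → b2n-mono (R⊆R′ u′ v′)) u
      (sumFin-mono-< m (λ v′ → b2n-mono (R⊆R′ u v′)) v
        (subst₂ (λ a b → b2n a < b2n b) (sym Ruv) (sym R′uv) ≤-refl))

  pairCount-∨ : ∀ R R′ → pairCount (λ u v → R u v ∨ R′ u v) ≤ pairCount R + pairCount R′
  pairCount-∨ R R′ = begin
    pairCount (λ u v → R u v ∨ R′ u v)
      ≤⟨ sumFin-mono m (λ u → sumFin-mono m λ v → b2n-∨ (R u v) (R′ u v)) ⟩
    sumFin m (λ u → sumFin m λ v → b2n (R u v) + b2n (R′ u v))
      ≡⟨ sumFin-cong m (λ u → sumFin-+ m _ _) ⟩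
    sumFin m (λ u → sumFin m (λ v → b2n (R u v)) + sumFin m (λ v → b2n (R′ u v)))
      ≡⟨ sumFin-+ m _ _ ⟩
    pairCount R + pairCount R′ ∎
    where open ≤-Reasoning

  relSize-mono : ∀ {R R′} → (∀ u v → R u v ≡ true → R′ u v ≡ true) → relSize R ≤ relSize R′
  relSize-mono R⊆R′ =
    sumFin-mono m λ u → sumFin-mono m λ v → b2n-mono λ e →
      ∧-intro (proj₁ (∧-true e)) (R⊆R′ u v (proj₂ (∧-true e)))

  -- Each ordered pair (u, v) with R u v is counted at most once, as {u, v}.
  relSize-symmetrise : ∀ R → relSize (λ u v → R u v ∨ R v u) ≤ pairCount R
  relSize-symmetrise R = begin
    relSize (λ u v → R u v ∨ R v u)
      ≤⟨ sumFin-mono m (λ u → sumFin-mono m λ v → b2n-∧-∨ (toℕ u <ᵇ toℕ v) (R u v) (R v u)) ⟩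
    sumFin m (λ u → sumFin m λ v → lt u v (R u v) + lt u v (R v u))
      ≡⟨ trans (sumFin-cong m (λ u → sumFin-+ m _ _)) (sumFin-+ m _ _) ⟩
    sumFin m (λ u → sumFin m λ v → lt u v (R u v)) + sumFin m (λ u → sumFin m λ v → lt u v (R v u))
      ≡⟨ cong (sumFin m (λ u → sumFin m λ v → lt u v (R u v)) +_) (sumFin-swap m m (λ u v → lt u v (R v u))) ⟩
    sumFin m (λ u → sumFin m λ v → lt u v (R u v)) + sumFin m (λ v → sumFin m λ u → lt u v (R v u))
      ≡⟨ sym (trans (sumFin-cong m (λ u → sumFin-+ m _ _)) (sumFin-+ m _ _)) ⟩
    sumFin m (λ u → sumFin m λ v → lt u v (R u v) + lt v u (R u v))
      ≤⟨ sumFin-mono m (λ u → sumFin-mono m λ v → exclusive (toℕ u) (toℕ v) (R u v)) ⟩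
    pairCount R ∎
    where
    open ≤-Reasoning
    lt : Fin m → Fin m → Bool → ℕ
    lt u v b = b2n ((toℕ u <ᵇ toℕ v) ∧ b)
    exclusive : ∀ i j b → b2n ((i <ᵇ j) ∧ b) + b2n ((j <ᵇ i) ∧ b) ≤ b2n b
    exclusive zero zero _ = z≤n
    exclusive zero (suc j) b = ≤-reflexive (+-identityʳ (b2n b))
    exclusive (suc i) zero _ = ≤-refl
    exclusive (suc i) (suc j) b = exclusive i j b

spanned : (G : Graph) (R : Fin (n G) → Fin (n G) → Bool) → (∀ u v → R u v ≡ true → adj G u v ≡ true) → EdgeSet G
spanned G R R⊆G = record
  { mem = λ u v → R u v ∨ R v u
  ; memSym = λ u v → Bool.∨-comm (R u v) (R v u)
  ; sub = λ u v e → [ R⊆G u v , trans (Graph.sym G u v) ∘ R⊆G v u ]′ (∨-true e)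
  }

size-spanned : ∀ G R R⊆G → size (spanned G R R⊆G) ≤ Counting.pairCount (n G) R
size-spanned G R _ = Counting.relSize-symmetrise (n G) R

pairCount-single : ∀ m a b → Counting.pairCount m (λ u v → (toℕ u ≡ᵇ a) ∧ (toℕ v ≡ᵇ b)) ≤ 1
pairCount-single m a b = begin
    sumFin m (λ u → sumFin m λ v → b2n ((toℕ u ≡ᵇ a) ∧ (toℕ v ≡ᵇ b)))
      ≡⟨ sumFin-cong m (λ u → trans (sumFin-cong m λ v → b2n-∧ (toℕ u ≡ᵇ a) _) (sumFin-*ˡ m (b2n (toℕ u ≡ᵇ a)) _)) ⟩
    sumFin m (λ u → b2n (toℕ u ≡ᵇ a) * sumFin m λ v → b2n (toℕ v ≡ᵇ b))
      ≤⟨ sumFin-mono m (λ u → *-monoʳ-≤ (b2n (toℕ u ≡ᵇ a)) (sumFin-toℕ≡ᵇ≤1 m b)) ⟩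
    sumFin m (λ u → b2n (toℕ u ≡ᵇ a) * 1)
      ≡⟨ sumFin-cong m (λ u → *-identityʳ _) ⟩
    sumFin m (λ u → b2n (toℕ u ≡ᵇ a))
      ≤⟨ sumFin-toℕ≡ᵇ≤1 m a ⟩
    1 ∎
  where open ≤-Reasoning

pairCount-successor : ∀ m → Counting.pairCount (suc m) (λ u v → suc (toℕ u) ≡ᵇ toℕ v) ≤ m
pairCount-successor m = begin
    sumFin (suc m) (λ u → sumFin (suc m) λ v → b2n (suc (toℕ u) ≡ᵇ toℕ v))
      ≡⟨ sumFin-swap (suc m) (suc m) (λ u v → b2n (suc (toℕ u) ≡ᵇ toℕ v)) ⟩
    sumFin (suc m) (λ _ → 0) + sumFin m (λ v → sumFin (suc m) λ u → b2n (toℕ u ≡ᵇ toℕ v))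
      ≡⟨ cong (_+ sumFin m (λ v → sumFin (suc m) λ u → b2n (toℕ u ≡ᵇ toℕ v))) (sumFin-zero (suc m)) ⟩
    sumFin m (λ v → sumFin (suc m) λ u → b2n (toℕ u ≡ᵇ toℕ v))
      ≤⟨ sumFin≤n*c m 1 _ (λ v → sumFin-toℕ≡ᵇ≤1 (suc m) (toℕ v)) ⟩
    m * 1
      ≡⟨ *-identityʳ m ⟩
    m ∎
  where open ≤-Reasoning

-- Bond bootstrap percolation

module Bootstrap (G : Graph) where

  Rel : Set
  Rel = Fin (n G) → Fin (n G) → Bool

  infix 4 _⊆_ _≐_

  _⊆_ : Rel → Rel → Set
  f ⊆ g = ∀ u v → f u v ≡ true → g u v ≡ true

  _≐_ : Rel → Rel → Set
  f ≐ g = ∀ u v → f u v ≡ g u v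

  Closed : ℕ → Rel → Set
  Closed r W = ∀ u v → adj G u v ≡ true → r ≤ degIn W u ⊎ r ≤ degIn W v → W u v ≡ true

  open Counting (n G) public

  Percolates : ℕ → ℕ → Rel → Set
  Percolates r t f = adj G ⊆ iter G r t f

  degIn-mono : ∀ {f g} → f ⊆ g → ∀ u → degIn f u ≤ degIn g u
  degIn-mono f⊆g u = sumFin-mono (n G) λ v → b2n-mono (f⊆g u v)

  degIn-cong : ∀ {f g} → f ≐ g → ∀ u → degIn f u ≡ degIn g u
  degIn-cong f≐g u = sumFin-cong (n G) λ v → cong b2n (f≐g u v)

  iter-inflationary : ∀ r t f → iter G r t f ⊆ iter G r (suc t) f
  iter-inflationary r t f u v = ∨-introˡ _

  iter-mono : ∀ r f {t t′} → t ≤ t′ → iter G r t f ⊆ iter G r t′ f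
  iter-mono r f {t} {zero} z≤n u v e = e
  iter-mono r f {t} {suc t′} t≤1+t′ u v e with m≤n⇒m<n∨m≡n t≤1+t′
  ... | inj₂ refl = e
  ... | inj₁ (s≤s t≤t′) = iter-inflationary r t′ f u v (iter-mono r f t≤t′ u v e)

  iter-cong : ∀ r {f g} → f ≐ g → ∀ t → iter G r t f ≐ iter G r t g
  iter-cong r f≐g zero = f≐g
  iter-cong r f≐g (suc t) u v
    rewrite iter-cong r f≐g t u v
          | degIn-cong (iter-cong r f≐g t) u | degIn-cong (iter-cong r f≐g t) v = refl

  iter-⊆-adj : ∀ r {f} → f ⊆ adj G → ∀ t → iter G r t f ⊆ adj G
  iter-⊆-adj r f⊆G zero = f⊆G
  iter-⊆-adj r f⊆G (suc t) u v e with ∨-true e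
  ... | inj₁ old = iter-⊆-adj r f⊆G t u v old
  ... | inj₂ new = proj₁ (∧-true new)

  iter-⊆-closed : ∀ r {f W} → f ⊆ W → Closed r W → ∀ t → iter G r t f ⊆ W
  iter-⊆-closed r f⊆W closed zero = f⊆W
  iter-⊆-closed r {f} {W} f⊆W closed (suc t) u v e with ∨-true e
  ... | inj₁ old = iter-⊆-closed r f⊆W closed t u v old
  ... | inj₂ new with ∧-true new
  ... | uv∈G , fires = closed u v uv∈G (Data.Sum.map (threshold u) (threshold v) (∨-true fires))
    where
    threshold : ∀ w → not (degIn (iter G r t f) w <ᵇ r) ≡ true → r ≤ degIn W w
    threshold w e′ = ≤-trans (not<ᵇ⇒≥ _ r e′) (degIn-mono (iter-⊆-closed r f⊆W closed t) w)

  Stable : ℕ → ℕ → Rel → Set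
  Stable r t f = iter G r (suc t) f ≐ iter G r t f

  stable? : ∀ r t f → Dec (Stable r t f)
  stable? r t f = Fin.all? λ u → Fin.all? λ v → iter G r (suc t) f u v Bool.≟ iter G r t f u v

  stable⇒closed : ∀ r t f → Stable r t f → Closed r (iter G r t f)
  stable⇒closed r t f stable u v uv∈G fires =
    trans (sym (stable u v))
          (∨-introʳ _ (∧-intro uv∈G ([ ∨-introˡ _ ∘ ≥⇒not<ᵇ , ∨-introʳ _ ∘ ≥⇒not<ᵇ ]′ fires)))

  unstable⇒new-pair : ∀ r t f → ¬ Stable r t f →
                      Σ _ λ u → Σ _ λ v → iter G r t f u v ≡ false × iter G r (suc t) f u v ≡ true
  unstable⇒new-pair r t f unstable
    with Fin.¬∀⟶∃¬ (n G) _ (λ u → Fin.all? λ v → iter G r (suc t) f u v Bool.≟ iter G r t f u v) unstable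
  ... | u , ¬∀v with Fin.¬∀⟶∃¬ (n G) _ (λ v → iter G r (suc t) f u v Bool.≟ iter G r t f u v) ¬∀v
  ... | v , differ = u , v , strictly-above (iter-inflationary r t f u v) differ
    where
    strictly-above : ∀ {a b : Bool} → (a ≡ true → b ≡ true) → b ≢ a → a ≡ false × b ≡ true
    strictly-above {false} {false} _ b≢a = ⊥-elim (b≢a refl)
    strictly-above {false} {true} _ _ = refl , refl
    strictly-above {true} a⇒b b≢a = ⊥-elim (b≢a (a⇒b refl))

  stabilised-or-grown : ∀ r f t → (Σ ℕ λ s → s ≤ t × Stable r s f) ⊎ t ≤ pairCount (iter G r t f)
  stabilised-or-grown r f zero = inj₂ z≤n
  stabilised-or-grown r f (suc t) with stabilised-or-grown r f t
  ... | inj₁ (s , s≤t , stable) = inj₁ (s , m≤n⇒m≤1+n s≤t , stable)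
  ... | inj₂ t≤count with stable? r t f
  ... | yes stable = inj₁ (t , n≤1+n t , stable)
  ... | no unstable with unstable⇒new-pair r t f unstable
  ... | u , v , old , new = inj₂ (≤-trans (s≤s t≤count) (pairCount-mono-< (iter-inflationary r t f) u v old new))

  -- Every step before stabilisation infects a new ordered pair, so T∞ steps suffice.
  T∞ : ℕ
  T∞ = suc (n G * (n G * 1))

  stabilises : ∀ r f → Σ ℕ λ t → t ≤ T∞ × Stable r t f
  stabilises r f with stabilised-or-grown r f T∞
  ... | inj₁ stable = stable
  ... | inj₂ T∞≤count = ⊥-elim (1+n≰n (≤-trans T∞≤count (pairCount≤ (iter G r T∞ f))))

  percolates-by-T∞ : ∀ r f t → Percolates r t f → Percolates r T∞ f
  percolates-by-T∞ r f t perc u v uv∈G with stabilises r f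
  ... | s , s≤T∞ , stable =
    iter-mono r f s≤T∞ u v
      (iter-⊆-closed r (iter-mono r f {0} {s} z≤n) (stable⇒closed r s f stable) t u v (perc u v uv∈G))

  percolates-if-closed-supersets-full :
    ∀ r f → f ⊆ adj G → (∀ W → f ⊆ W → W ⊆ adj G → Closed r W → adj G ⊆ W) → Percolates r T∞ f
  percolates-if-closed-supersets-full r f f⊆G full u v uv∈G with stabilises r f
  ... | s , s≤T∞ , stable =
    iter-mono r f s≤T∞ u v
      (full (iter G r s f) (iter-mono r f {0} {s} z≤n) (iter-⊆-adj r f⊆G s) (stable⇒closed r s f stable) u v uv∈G)

-- Existence of a minimum percolating set

module _ {p} {P : ℕ → Set p} (P? : ∀ m → Dec (P m)) where

  private
    search : ∀ b → (Σ ℕ λ m → P m × (∀ m′ → P m′ → m ≤ m′)) ⊎ (∀ m → m < b → ¬ P m)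
    search zero = inj₂ λ _ ()
    search (suc b) with search b
    ... | inj₁ least = inj₁ least
    ... | inj₂ none-below with P? b
    ... | yes Pb = inj₁ (b , Pb , λ m′ Pm′ → ≮⇒≥ λ m′<b → none-below m′ m′<b Pm′)
    ... | no ¬Pb = inj₂ λ m m<1+b →
      [ none-below m , (λ { refl → ¬Pb }) ]′ (m≤n⇒m<n∨m≡n (s≤s⁻¹ m<1+b))

  least-witness : ∀ {m₀} → P m₀ → Σ ℕ λ m → P m × (∀ m′ → P m′ → m ≤ m′)
  least-witness {m₀} Pm₀ with search (suc m₀)
  ... | inj₁ least = least
  ... | inj₂ none = ⊥-elim (none m₀ ≤-refl Pm₀)

module Minimum (G : Graph) (r : ℕ) where
  open Bootstrap G

  PercolatingOfSize : ℕ → Rel → Set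
  PercolatingOfSize m R = (∀ i j → R i j ≡ R j i) × R ⊆ adj G × Percolates r T∞ R × relSize R ≡ m

  percolatingOfSize? : ∀ m R → Dec (PercolatingOfSize m R)
  percolatingOfSize? m R =
    (Fin.all? λ i → Fin.all? λ j → R i j Bool.≟ R j i)
    ×-dec (Fin.all? λ i → Fin.all? λ j → (R i j Bool.≟ true) →-dec (adj G i j Bool.≟ true))
    ×-dec (Fin.all? λ u → Fin.all? λ v → (adj G u v Bool.≟ true) →-dec (iter G r T∞ R u v Bool.≟ true))
    ×-dec (relSize R ≟ m)

  percolatingOfSize-cong : ∀ {m R R′} → R ≐ R′ → PercolatingOfSize m R → PercolatingOfSize m R′
  percolatingOfSize-cong R≐R′ (symmetric , R⊆G , perc , size≡m) =
    (λ i j → trans (sym (R≐R′ i j)) (trans (symmetric i j) (R≐R′ j i))) ,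
    (λ i j → R⊆G i j ∘ trans (R≐R′ i j)) ,
    (λ u v → trans (sym (iter-cong r R≐R′ T∞ u v)) ∘ perc u v) ,
    trans (sumFin-cong (n G) λ i → sumFin-cong (n G) λ j → cong (λ b → b2n ((toℕ i <ᵇ toℕ j) ∧ b)) (sym (R≐R′ i j)))
          size≡m

  -- Relations on Fin (n G) are coded as subsets of Fin (n G * n G), so that
  -- the existence of one of a given size is decidable by exhaustive search.
  decode : Subset (n G * n G) → Rel
  decode s i j = lookup s (combine i j)

  encode : Rel → Subset (n G * n G)
  encode R = tabulate λ x → uncurry R (remQuot (n G) x)

  decode-encode : ∀ R → decode (encode R) ≐ R
  decode-encode R i j = trans (lookup∘tabulate _ (combine i j)) (cong (uncurry R) (Fin.remQuot-combine i j))

  CodedOfSize : ℕ → Set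
  CodedOfSize m = Σ (Subset (n G * n G)) λ s → PercolatingOfSize m (decode s)

  coded : (S : EdgeSet G) → Percolating G r S → CodedOfSize (size S)
  coded S (t , perc) =
    encode (mem S) ,
    percolatingOfSize-cong (λ i j → sym (decode-encode (mem S) i j))
      (memSym S , sub S , percolates-by-T∞ r (mem S) t perc , refl)

  minimum-exists : (S₀ : EdgeSet G) → Percolating G r S₀ → ∀ {u} → size S₀ ≤ u → Σ ℕ λ m → IsMe G r m × m ≤ u
  minimum-exists S₀ perc₀ S₀≤u
    with least-witness (λ m → anySubset? (percolatingOfSize? m ∘ decode)) (coded S₀ perc₀)
  ... | m , (s , symmetric , R⊆G , perc , size≡m) , least =
    m , ((S , (T∞ , perc) , size≡m) , λ S′ perc′ → least (size S′) (coded S′ perc′)) ,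
    ≤-trans (least (size S₀) (coded S₀ perc₀)) S₀≤u
    where S = record { mem = decode s ; memSym = symmetric ; sub = R⊆G }

-- Cartesian products

simpleAdj-id : ∀ {m} (raw : Fin m → Fin m → Bool) →
               (∀ x y → raw x y ≡ raw y x) → (∀ x → raw x x ≡ false) → ∀ x y → simpleAdj raw x y ≡ raw x y
simpleAdj-id raw symmetric irreflexive x y with x Fin.≟ y
... | yes refl = sym (irreflexive x)
... | no _ rewrite symmetric y x = Bool.∨-idem (raw x y)

module Product (G H : Graph) where

  P : Graph
  P = G □ H

  private
    module BG = Bootstrap G
    module BH = Bootstrap H
    module BP = Bootstrap P

  pairAdj : Fin (n G) × Fin (n H) → Fin (n G) × Fin (n H) → Bool
  pairAdj (g , h) (g′ , h′) = (eqF g g′ ∧ adj H h h′) ∨ (eqF h h′ ∧ adj G g g′)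

  □adj≡pairAdj : ∀ x y → (G □adj H) x y ≡ pairAdj (remQuot (n H) x) (remQuot (n H) y)
  □adj≡pairAdj x y with remQuot {n G} (n H) x | remQuot {n G} (n H) y
  ... | _ | _ = refl

  pairAdj-sym : ∀ p q → pairAdj p q ≡ pairAdj q p
  pairAdj-sym (g , h) (g′ , h′)
    rewrite eqF-sym g g′ | eqF-sym h h′ | Graph.sym H h h′ | Graph.sym G g g′ = refl

  pairAdj-irrefl : ∀ p → pairAdj p p ≡ false
  pairAdj-irrefl (g , h) rewrite eqF-refl g | eqF-refl h | irrefl H h | irrefl G g = refl

  adj≡pairAdj : ∀ x y → adj P x y ≡ pairAdj (remQuot (n H) x) (remQuot (n H) y)
  adj≡pairAdj x y = trans (simpleAdj-id (G □adj H) □-sym □-irrefl x y) (□adj≡pairAdj x y)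
    where
    □-sym : ∀ x y → (G □adj H) x y ≡ (G □adj H) y x
    □-sym x y = trans (□adj≡pairAdj x y) (trans (pairAdj-sym (remQuot {n G} (n H) x) _) (sym (□adj≡pairAdj y x)))
    □-irrefl : ∀ x → (G □adj H) x x ≡ false
    □-irrefl x = trans (□adj≡pairAdj x x) (pairAdj-irrefl (remQuot {n G} (n H) x))

  adj-combine : ∀ g h g′ h′ → adj P (combine g h) (combine g′ h′) ≡ pairAdj (g , h) (g′ , h′)
  adj-combine g h g′ h′ =
    trans (adj≡pairAdj _ _) (cong₂ pairAdj (Fin.remQuot-combine g h) (Fin.remQuot-combine g′ h′))

  adj-layer : ∀ g g′ h → adj P (combine g h) (combine g′ h) ≡ adj G g g′
  adj-layer g g′ h rewrite adj-combine g h g′ h | irrefl H h | eqF-refl h | Bool.∧-zeroʳ (eqF g g′) = refl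

  adj-fiber : ∀ g h h′ → adj P (combine g h) (combine g h′) ≡ adj H h h′
  adj-fiber g h h′
    rewrite adj-combine g h g h′ | irrefl G g | eqF-refl g | Bool.∧-zeroʳ (eqF h h′) = Bool.∨-identityʳ _

  seedPair : (Fin (n H) → BG.Rel) → (Fin (n G) → BH.Rel) → Fin (n G) × Fin (n H) → Fin (n G) × Fin (n H) → Bool
  seedPair L F (g , h) (g′ , h′) = (eqF h h′ ∧ L h g g′) ∨ (eqF g g′ ∧ F g h h′)

  seed : (Fin (n H) → EdgeSet G) → (Fin (n G) → EdgeSet H) → EdgeSet P
  seed L F = record
    { mem = λ x y → seedPair (mem ∘ L) (mem ∘ F) (remQuot (n H) x) (remQuot (n H) y)
    ; memSym = λ x y → seedPair-sym (remQuot {n G} (n H) x) (remQuot {n G} (n H) y)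
    ; sub = λ x y e → trans (adj≡pairAdj x y) (seedPair⊆pairAdj (remQuot {n G} (n H) x) (remQuot {n G} (n H) y) e)
    }
    where
    seedPair-sym : ∀ p q → seedPair (mem ∘ L) (mem ∘ F) p q ≡ seedPair (mem ∘ L) (mem ∘ F) q p
    seedPair-sym (g , h) (g′ , h′) =
      cong₂ _∨_ (eqF-∧-sym h h′ λ { refl → memSym (L h) g g′ }) (eqF-∧-sym g g′ λ { refl → memSym (F g) h h′ })
    seedPair⊆pairAdj : ∀ p q → seedPair (mem ∘ L) (mem ∘ F) p q ≡ true → pairAdj p q ≡ true
    seedPair⊆pairAdj (g , h) (g′ , h′) e with ∨-true e
    ... | inj₁ in-layer with ∧-true in-layer
    ... | h≡h′ , gg′∈L with eqF⇒≡ h h′ h≡h′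
    ... | refl = ∨-introʳ _ (∧-intro h≡h′ (sub (L h) g g′ gg′∈L))
    seedPair⊆pairAdj (g , h) (g′ , h′) e | inj₂ in-fiber with ∧-true in-fiber
    ... | g≡g′ , hh′∈F with eqF⇒≡ g g′ g≡g′
    ... | refl = ∨-introˡ _ (∧-intro g≡g′ (sub (F g) h h′ hh′∈F))

  seed-combine : ∀ L F g h g′ h′ →
                 mem (seed L F) (combine g h) (combine g′ h′) ≡ seedPair (mem ∘ L) (mem ∘ F) (g , h) (g′ , h′)
  seed-combine L F g h g′ h′ =
    cong₂ (seedPair (mem ∘ L) (mem ∘ F)) (Fin.remQuot-combine g h) (Fin.remQuot-combine g′ h′)

  combine-cancelˡ-< : ∀ {g g′ : Fin (n G)} (h : Fin (n H)) → toℕ (combine g h) < toℕ (combine g′ h) → toℕ g < toℕ g′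
  combine-cancelˡ-< {g} {g′} h lt =
    *-cancelˡ-< (n H) _ _ (+-cancelʳ-< (toℕ h) _ _ (subst₂ _<_ (Fin.toℕ-combine g h) (Fin.toℕ-combine g′ h) lt))

  combine-cancelʳ-< : ∀ (g : Fin (n G)) {h h′ : Fin (n H)} → toℕ (combine g h) < toℕ (combine g h′) → toℕ h < toℕ h′
  combine-cancelʳ-< g {h} {h′} lt =
    +-cancelˡ-< (n H * toℕ g) _ _ (subst₂ _<_ (Fin.toℕ-combine g h) (Fin.toℕ-combine g h′) lt)

  size-seed : ∀ L F → size (seed L F) ≤ sumFin (n H) (λ h → size (L h)) + sumFin (n G) (λ g → size (F g))
  size-seed L F = begin
      size (seed L F)
        ≡⟨ trans (sumFin-combine (n G) (n H) _)
                 (sumFin-cong (n G) λ g → sumFin-cong (n H) λ h → sumFin-combine (n G) (n H) _) ⟩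
      sumFin (n G) (λ g → sumFin (n H) λ h → sumFin (n G) λ g′ → sumFin (n H) λ h′ → term g h g′ h′)
        ≤⟨ sumFin-mono (n G) (λ g → sumFin-mono (n H) λ h → row≤ g h) ⟩
      sumFin (n G) (λ g → sumFin (n H) λ h → sumFin (n G) (layerTerm h g) + sumFin (n H) (fiberTerm g h))
        ≡⟨ trans (sumFin-cong (n G) (λ g → sumFin-+ (n H) _ _)) (sumFin-+ (n G) _ _) ⟩
      sumFin (n G) (λ g → sumFin (n H) λ h → sumFin (n G) (layerTerm h g)) + sumFin (n G) (λ g → size (F g))
        ≡⟨ cong (_+ sumFin (n G) (λ g → size (F g))) (sumFin-swap (n G) (n H) λ g h → sumFin (n G) (layerTerm h g)) ⟩
      sumFin (n H) (λ h → size (L h)) + sumFin (n G) (λ g → size (F g)) ∎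
    where
    open ≤-Reasoning
    lt : Fin (n G * n H) → Fin (n G * n H) → Bool
    lt x y = toℕ x <ᵇ toℕ y
    term : Fin (n G) → Fin (n H) → Fin (n G) → Fin (n H) → ℕ
    term g h g′ h′ = b2n (lt (combine g h) (combine g′ h′) ∧ mem (seed L F) (combine g h) (combine g′ h′))
    layerTerm : Fin (n H) → Fin (n G) → Fin (n G) → ℕ
    layerTerm h g g′ = b2n ((toℕ g <ᵇ toℕ g′) ∧ mem (L h) g g′)
    fiberTerm : Fin (n G) → Fin (n H) → Fin (n H) → ℕ
    fiberTerm g h h′ = b2n ((toℕ h <ᵇ toℕ h′) ∧ mem (F g) h h′)

    layer-order : ∀ g h g′ h′ → eqF h h′ ≡ true → lt (combine g h) (combine g′ h′) ≡ true → (toℕ g <ᵇ toℕ g′) ≡ true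
    layer-order g h g′ h′ h≡h′ c with eqF⇒≡ h h′ h≡h′
    ... | refl = <ᵇ-< (combine-cancelˡ-< h (does⇒ (_ <? _) c))

    fiber-order : ∀ g h g′ h′ → eqF g g′ ≡ true → lt (combine g h) (combine g′ h′) ≡ true → (toℕ h <ᵇ toℕ h′) ≡ true
    fiber-order g h g′ h′ g≡g′ c with eqF⇒≡ g g′ g≡g′
    ... | refl = <ᵇ-< (combine-cancelʳ-< g (does⇒ (_ <? _) c))

    term≤ : ∀ g h g′ h′ → term g h g′ h′ ≤ b2n (eqF h h′) * layerTerm h g g′ + b2n (eqF g g′) * fiberTerm g h h′
    term≤ g h g′ h′ rewrite seed-combine L F g h g′ h′ =
      ≤-trans (b2n-∧-∨ (lt (combine g h) (combine g′ h′)) _ _)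
              (+-mono-≤ (b2n-∧-guarded _ (eqF h h′) _ (layer-order g h g′ h′))
                        (b2n-∧-guarded _ (eqF g g′) _ (fiber-order g h g′ h′)))

    row≤ : ∀ g h → sumFin (n G) (λ g′ → sumFin (n H) λ h′ → term g h g′ h′)
                   ≤ sumFin (n G) (layerTerm h g) + sumFin (n H) (fiberTerm g h)
    row≤ g h = begin
        sumFin (n G) (λ g′ → sumFin (n H) λ h′ → term g h g′ h′)
          ≤⟨ sumFin-mono (n G) (λ g′ → sumFin-mono (n H) λ h′ → term≤ g h g′ h′) ⟩
        sumFin (n G) (λ g′ → sumFin (n H) λ h′ → b2n (eqF h h′) * layerTerm h g g′ + b2n (eqF g g′) * fiberTerm g h h′)
          ≡⟨ trans (sumFin-cong (n G) (λ g′ → sumFin-+ (n H) _ _)) (sumFin-+ (n G) _ _) ⟩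
        sumFin (n G) (λ g′ → sumFin (n H) λ h′ → b2n (eqF h h′) * layerTerm h g g′)
          + sumFin (n G) (λ g′ → sumFin (n H) λ h′ → b2n (eqF g g′) * fiberTerm g h h′)
          ≡⟨ cong (sumFin (n G) (λ g′ → sumFin (n H) λ h′ → b2n (eqF h h′) * layerTerm h g g′) +_)
                  (sumFin-swap (n G) (n H) λ g′ h′ → b2n (eqF g g′) * fiberTerm g h h′) ⟩
        sumFin (n G) (λ g′ → sumFin (n H) λ h′ → b2n (eqF h h′) * layerTerm h g g′)
          + sumFin (n H) (λ h′ → sumFin (n G) λ g′ → b2n (eqF g g′) * fiberTerm g h h′)
          ≤⟨ +-mono-≤ (sumFin-mono (n G) λ g′ → sumFin-eqF*≤ h (layerTerm h g g′))
                      (sumFin-mono (n H) λ h′ → sumFin-eqF*≤ g (fiberTerm g h h′)) ⟩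
        sumFin (n G) (layerTerm h g) + sumFin (n H) (fiberTerm g h) ∎

  by-combine : ∀ {q} (Φ : Fin (n G * n H) → Set q) → (∀ g h → Φ (combine g h)) → ∀ x → Φ x
  by-combine Φ Φ-combine x =
    subst Φ (Fin.combine-remQuot {n G} (n H) x) (uncurry Φ-combine (remQuot {n G} (n H) x))

  module ClosedSet (r : ℕ) (W : BP.Rel) (W⊆P : W BP.⊆ adj P) (closed : BP.Closed r W) where

    layer : Fin (n H) → BG.Rel
    layer h g g′ = W (combine g h) (combine g′ h)

    fiber : Fin (n G) → BH.Rel
    fiber g h h′ = W (combine g h) (combine g h′)

    LayerFull : Fin (n H) → Set
    LayerFull h = adj G BG.⊆ layer h

    W-irrefl : ∀ x → W x x ≡ false
    W-irrefl x with W x x in Wxx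
    ... | false = refl
    ... | true with trans (sym (W⊆P x x Wxx)) (irrefl P x)
    ... | ()

    layer⊆G : ∀ h → layer h BG.⊆ adj G
    layer⊆G h g g′ = subst (_≡ true) (adj-layer g g′ h) ∘ W⊆P _ _

    -- The two neighbourhoods only share (g , h), which is not a W-neighbour of itself.
    degIn-layer+fiber : ∀ g h → degIn (layer h) g + degIn (fiber g) h ≤ degIn W (combine g h)
    degIn-layer+fiber g h = begin
        degIn (layer h) g + degIn (fiber g) h
          ≤⟨ +-monoʳ-≤ (degIn (layer h) g) fiber≤column ⟩
        sumFin (n G) (λ g′ → w g′ h) + sumFin (n G) (λ g′ → b2n (eqF g′ g) * F)
          ≡⟨ sym (sumFin-+ (n G) _ _) ⟩
        sumFin (n G) (λ g′ → w g′ h + b2n (eqF g′ g) * F)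
          ≤⟨ sumFin-mono (n G) row≥ ⟩
        sumFin (n G) (λ g′ → sumFin (n H) (w g′))
          ≡⟨ sym (sumFin-combine (n G) (n H) (b2n ∘ W (combine g h))) ⟩
        degIn W (combine g h) ∎
      where
      open ≤-Reasoning
      w : Fin (n G) → Fin (n H) → ℕ
      w g′ h′ = b2n (W (combine g h) (combine g′ h′))
      F = degIn (fiber g) h
      fiber≤column : F ≤ sumFin (n G) (λ g′ → b2n (eqF g′ g) * F)
      fiber≤column = subst (_≤ sumFin (n G) (λ g′ → b2n (eqF g′ g) * F))
                           (trans (cong (λ b → b2n b * F) (eqF-refl g)) (*-identityˡ F))
                           (term≤sumFin (n G) (λ g′ → b2n (eqF g′ g) * F) g)
      row≥ : ∀ g′ → w g′ h + b2n (eqF g′ g) * F ≤ sumFin (n H) (w g′)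
      row≥ g′ with g′ Fin.≟ g
      ... | yes refl rewrite W-irrefl (combine g h) = ≤-reflexive (+-identityʳ _)
      ... | no _ = ≤-trans (≤-reflexive (+-identityʳ _)) (term≤sumFin (n H) (w g′) h)

    seed⊆⇒layer : ∀ {L F} → mem (seed L F) BP.⊆ W → ∀ h → mem (L h) BG.⊆ layer h
    seed⊆⇒layer {L} {F} seed⊆W h g g′ e =
      seed⊆W _ _ (trans (seed-combine L F g h g′ h) (∨-introˡ _ (∧-intro (eqF-refl h) e)))

    seed⊆⇒fiber : ∀ {L F} → mem (seed L F) BP.⊆ W → ∀ g → mem (F g) BH.⊆ fiber g
    seed⊆⇒fiber {L} {F} seed⊆W g h h′ e =
      seed⊆W _ _ (trans (seed-combine L F g h g h′) (∨-introʳ (eqF h h′ ∧ mem (L h) g g) (∧-intro (eqF-refl g) e)))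

    layer-closed : ∀ h s j → r ≤ s + j → (∀ g → s ≤ degIn (adj G) g → j ≤ degIn (fiber g) h) →
                   BG.Closed s (layer h)
    layer-closed h s j r≤s+j fiber-bound g g′ gg′∈G fires =
      closed _ _ (trans (adj-layer g g′ h) gg′∈G) (Data.Sum.map (reaches-r g) (reaches-r g′) fires)
      where
      reaches-r : ∀ u → s ≤ degIn (layer h) u → r ≤ degIn W (combine u h)
      reaches-r u s≤deg =
        ≤-trans r≤s+j (≤-trans (+-mono-≤ s≤deg (fiber-bound u (≤-trans s≤deg (BG.degIn-mono (layer⊆G h) u))))
                               (degIn-layer+fiber u h))

    layer-full : ∀ h s j → r ≤ s + j → (∀ g → s ≤ degIn (adj G) g → j ≤ degIn (fiber g) h) →
                 (B : EdgeSet G) → Percolating G s B → mem B BG.⊆ layer h → LayerFull h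
    layer-full h s j r≤s+j fiber-bound B (t , perc) B⊆layer u v uv∈G =
      BG.iter-⊆-closed s B⊆layer (layer-closed h s j r≤s+j fiber-bound) t u v (perc u v uv∈G)

    fiber-fires : ∀ g h → LayerFull h → r ≤ degIn (adj G) g + degIn (fiber g) h →
                  ∀ h′ → adj H h h′ ≡ true → fiber g h h′ ≡ true × fiber g h′ h ≡ true
    fiber-fires g h full r≤deg h′ hh′∈H =
      closed _ _ (trans (adj-fiber g h h′) hh′∈H) (inj₁ r≤degW) ,
      closed _ _ (trans (adj-fiber g h′ h) (trans (Graph.sym H h′ h) hh′∈H)) (inj₂ r≤degW)
      where
      r≤degW : r ≤ degIn W (combine g h)
      r≤degW = ≤-trans r≤deg (≤-trans (+-monoˡ-≤ _ (BG.degIn-mono full g)) (degIn-layer+fiber g h))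

    contains-P : (∀ h → LayerFull h) → (∀ g → adj H BH.⊆ fiber g) → adj P BP.⊆ W
    contains-P layers fibers =
      by-combine _ λ g h → by-combine _ λ g′ h′ → edge g h g′ h′ ∘ trans (sym (adj-combine g h g′ h′))
      where
      edge : ∀ g h g′ h′ → pairAdj (g , h) (g′ , h′) ≡ true → W (combine g h) (combine g′ h′) ≡ true
      edge g h g′ h′ e with ∨-true e
      ... | inj₁ same-g with ∧-true same-g
      ... | g≡g′ , hh′∈H with eqF⇒≡ g g′ g≡g′
      ... | refl = fibers g h h′ hh′∈H
      edge g h g′ h′ e | inj₂ same-h with ∧-true same-h
      ... | h≡h′ , gg′∈G with eqF⇒≡ h h′ h≡h′
      ... | refl = layers h g g′ gg′∈G


-- The percolating set of G □ H_{k,ℓ}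

layerChoice : ∀ {a} {X : Set a} → ℕ → ℕ → X → X → X → X
layerChoice M i x y z = if i ≡ᵇ 0 then x else if (i ≡ᵇ 1) ∨ (i ≡ᵇ suc M) then z else y

layerChoice-map : ∀ {a b} {X : Set a} {Y : Set b} (f : X → Y) M i x y z →
                  f (layerChoice M i x y z) ≡ layerChoice M i (f x) (f y) (f z)
layerChoice-map f M i x y z =
  trans (Bool.if-float f (i ≡ᵇ 0)) (Bool.if-cong-else (i ≡ᵇ 0) (Bool.if-float f ((i ≡ᵇ 1) ∨ (i ≡ᵇ suc M))))

layerChoice-middle : ∀ M i {a} {X : Set a} {x y z : X} → 2 ≤ i → i ≤ M → layerChoice M i x y z ≡ y
layerChoice-middle M 1 (s≤s ()) _
layerChoice-middle M i@(suc (suc j)) _ i≤M rewrite ≡ᵇ-≢ (<⇒≢ (s≤s i≤M)) = refl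

layerChoice-last : ∀ M {a} {X : Set a} {x y z : X} → layerChoice M (suc M) x y z ≡ z
layerChoice-last M rewrite ≡ᵇ-refl M | Bool.∨-zeroʳ (M ≡ᵇ 0) = refl

sumBelow-layerChoice : ∀ M a b c → 1 ≤ M → sumBelow (2 + M) (λ i → layerChoice M i a b c) ≤ a + (M ∸ 1) * b + 2 * c
sumBelow-layerChoice (suc M′) a b c _ = begin
    sumBelow (2 + M′) f + f (2 + M′)
      ≡⟨ cong₂ _+_ (trans (sumBelow-suc (1 + M′) f) (cong (a +_) (sumBelow-suc M′ (f ∘ suc))))
                   (cong (λ e → if e then c else b) (≡ᵇ-refl M′)) ⟩
    a + (c + sumBelow M′ (λ i → f (2 + i))) + c
      ≤⟨ +-monoˡ-≤ c (+-monoʳ-≤ a (+-monoʳ-≤ c (sumBelow-mono M′ {g = λ _ → b} λ i i<M′ →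
           ≤-reflexive (layerChoice-middle (suc M′) (2 + i) {x = a} {z = c} (s≤s (s≤s z≤n)) (s≤s i<M′))))) ⟩
    a + (c + sumBelow M′ (λ _ → b)) + c
      ≡⟨ cong (λ s → a + (c + s) + c) (sumBelow-const M′ b) ⟩
    a + (c + M′ * b) + c
      ≡⟨ solve 4 (λ a b c m → a :+ (c :+ m) :+ c := a :+ m :+ con 2 :* c) refl a b c (M′ * b) ⟩
    a + M′ * b + 2 * c ∎
  where
  open ≤-Reasoning
  open +-*-Solver
  f : ℕ → ℕ
  f i = layerChoice (suc M′) i a b c

degreeChoice : ∀ {a} {X : Set a} → ℕ → ℕ → X → X → X → X → X
degreeChoice r′ d x y z w = if d ≡ᵇ suc r′ then x else if d ≡ᵇ r′ then y else if d <ᵇ r′ then z else w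

data DegreeCase (r′ d : ℕ) : Set where
  above  : suc (suc r′) ≤ d → DegreeCase r′ d
  at-r-1 : d ≡ suc r′ → DegreeCase r′ d
  at-r-2 : d ≡ r′ → DegreeCase r′ d
  below  : d < r′ → DegreeCase r′ d

degreeCase : ∀ r′ d → DegreeCase r′ d
degreeCase r′ d with <-cmp d r′
... | tri< d<r′ _ _ = below d<r′
... | tri≈ _ d≡r′ _ = at-r-2 d≡r′
... | tri> _ _ r′<d with m≤n⇒m<n∨m≡n r′<d
...   | inj₁ 1+r′<d = above 1+r′<d
...   | inj₂ 1+r′≡d = at-r-1 (sym 1+r′≡d)

module _ {a} {X : Set a} (r′ : ℕ) {x y z w : X} where

  degreeChoice-above : ∀ {d} → suc (suc r′) ≤ d → degreeChoice r′ d x y z w ≡ w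
  degreeChoice-above {d} 1+r′<d
    rewrite ≡ᵇ-≢ (>⇒≢ 1+r′<d) | ≡ᵇ-≢ (>⇒≢ (<-trans (n<1+n r′) 1+r′<d)) | <ᵇ-≮ (<-asym (<-trans (n<1+n r′) 1+r′<d)) = refl

  degreeChoice-r-1 : ∀ {d} → d ≡ suc r′ → degreeChoice r′ d x y z w ≡ x
  degreeChoice-r-1 refl rewrite ≡ᵇ-refl r′ = refl

  degreeChoice-r-2 : ∀ {d} → d ≡ r′ → degreeChoice r′ d x y z w ≡ y
  degreeChoice-r-2 refl rewrite ≡ᵇ-≢ (<⇒≢ (n<1+n r′)) | ≡ᵇ-refl r′ = refl

  degreeChoice-below : ∀ {d} → d < r′ → degreeChoice r′ d x y z w ≡ z
  degreeChoice-below {d} d<r′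
    rewrite ≡ᵇ-≢ (<⇒≢ (m<n⇒m<1+n d<r′)) | ≡ᵇ-≢ (<⇒≢ d<r′) | <ᵇ-< d<r′ = refl

module Theta (k′ ℓ′ : ℕ) where

  k ℓ : ℕ
  k = 4 + k′
  ℓ = 4 + ℓ′

  H : Graph
  H = theta k ℓ

  -- n H reduces to 2 + M; the vertices are 0, …, M + 1 and the chord joins 0 and L.
  M L : ℕ
  M = k′ + ℓ
  L = 3 + ℓ′

  Vertex : Set
  Vertex = Fin (n H)

  vertex : (i : ℕ) → .(i ≤ suc M) → Vertex
  vertex i i≤1+M = fromℕ< (s≤s i≤1+M)

  toℕ-vertex : ∀ i .(i≤1+M : i ≤ suc M) → toℕ (vertex i i≤1+M) ≡ i
  toℕ-vertex i i≤1+M = Fin.toℕ-fromℕ< (s≤s i≤1+M)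

  v0 v1 : Vertex
  v0 = vertex 0 z≤n
  v1 = vertex 1 (s≤s z≤n)

  toℕ-v0 : toℕ v0 ≡ 0
  toℕ-v0 = toℕ-vertex 0 z≤n

  toℕ-v1 : toℕ v1 ≡ 1
  toℕ-v1 = toℕ-vertex 1 (s≤s z≤n)

  vertex-cases : ∀ h → toℕ h ≡ 0 ⊎ toℕ h ≡ 1 ⊎ (2 ≤ toℕ h × toℕ h ≤ M) ⊎ toℕ h ≡ suc M
  vertex-cases h with toℕ h | Fin.toℕ<n h
  ... | 0 | _ = inj₁ refl
  ... | 1 | _ = inj₂ (inj₁ refl)
  ... | suc (suc i) | 2+i<2+M with suc (suc i) ≤? M
  ...   | yes 2+i≤M = inj₂ (inj₂ (inj₁ (s≤s (s≤s z≤n) , 2+i≤M)))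
  ...   | no 2+i≰M = inj₂ (inj₂ (inj₂ (≤-antisym (s≤s⁻¹ 2+i<2+M) (≰⇒> 2+i≰M))))

  1≤M : 1 ≤ M
  1≤M = ≤-trans (s≤s z≤n) (m≤n+m ℓ k′)

  L<M : L < M
  L<M = ≤-trans ≤-refl (m≤n+m ℓ k′)

  raw-irrefl : ∀ h → thetaRaw k ℓ h h ≡ false
  raw-irrefl h with toℕ h
  ... | zero = refl
  ... | suc t rewrite ≡ᵇ-≢ (<⇒≢ (n<1+n t) ∘ sym) = refl

  raw⊆adj : ∀ h h′ → thetaRaw k ℓ h h′ ≡ true → adj H h h′ ≡ true
  raw⊆adj h h′ e = ∧-intro (cong not (eqF-≢ h≢h′)) (∨-introˡ _ e)
    where
    h≢h′ : h ≢ h′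
    h≢h′ refl with trans (sym e) (raw-irrefl h)
    ... | ()

  adj-succ : ∀ h h′ → toℕ h′ ≡ suc (toℕ h) → adj H h h′ ≡ true
  adj-succ h h′ e = raw⊆adj h h′ (∨-introˡ _ (dec-true (suc (toℕ h) ≟ toℕ h′) (sym e)))

  adj-pred : ∀ h h′ → toℕ h ≡ suc (toℕ h′) → adj H h h′ ≡ true
  adj-pred h h′ e = trans (Graph.sym H h h′) (adj-succ h′ h e)

  adj-0-last : ∀ h h′ → toℕ h ≡ 0 → toℕ h′ ≡ suc M → adj H h h′ ≡ true
  adj-0-last h h′ h≡0 h′≡last =
    raw⊆adj h h′ (∨-introʳ (suc (toℕ h) ≡ᵇ toℕ h′) (∨-introˡ ((toℕ h ≡ᵇ 0) ∧ (toℕ h′ ≡ᵇ L)) (∧-intro (dec-true (toℕ h ≟ 0) h≡0) (dec-true (toℕ h′ ≟ suc M) h′≡last))))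

  adj-0-L : ∀ h h′ → toℕ h ≡ 0 → toℕ h′ ≡ L → adj H h h′ ≡ true
  adj-0-L h h′ h≡0 h′≡L =
    raw⊆adj h h′ (∨-introʳ (suc (toℕ h) ≡ᵇ toℕ h′) (∨-introʳ ((toℕ h ≡ᵇ 0) ∧ (toℕ h′ ≡ᵇ suc M)) (∧-intro (dec-true (toℕ h ≟ 0) h≡0) (dec-true (toℕ h′ ≟ L) h′≡L))))

  adj⇒≢ : ∀ h h′ → adj H h h′ ≡ true → toℕ h ≢ toℕ h′
  adj⇒≢ h h′ e h≡h′ with Fin.toℕ-injective h≡h′
  ... | refl with trans (sym e) (irrefl H h)
  ...   | ()

  firstPair successor : Vertex → Vertex → Bool
  firstPair h h′ = (toℕ h ≡ᵇ 0) ∧ (toℕ h′ ≡ᵇ 1)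
  successor h h′ = suc (toℕ h) ≡ᵇ toℕ h′

  firstPair-intro : ∀ {h h′} → toℕ h ≡ 0 → toℕ h′ ≡ 1 → firstPair h h′ ≡ true
  firstPair-intro {h} {h′} h≡0 h′≡1 = ∧-intro (dec-true (toℕ h ≟ 0) h≡0) (dec-true (toℕ h′ ≟ 1) h′≡1)

  firstPair⊆adj : ∀ h h′ → firstPair h h′ ≡ true → adj H h h′ ≡ true
  firstPair⊆adj h h′ e =
    adj-succ h h′ (trans (does⇒ (_ ≟ 1) (proj₂ (∧-true e))) (cong suc (sym (does⇒ (_ ≟ 0) (proj₁ (∧-true e))))))

  successor⊆adj : ∀ h h′ → successor h h′ ≡ true → adj H h h′ ≡ true
  successor⊆adj h h′ e = adj-succ h h′ (sym (does⇒ (_ ≟ _) e))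

  firstEdge pathEdges : EdgeSet H
  firstEdge = spanned H firstPair firstPair⊆adj
  pathEdges = spanned H successor successor⊆adj

  allEdges : EdgeSet H
  allEdges = record { mem = adj H ; memSym = Graph.sym H ; sub = λ _ _ e → e }

  noEdges : EdgeSet H
  noEdges = record { mem = λ _ _ → false ; memSym = λ _ _ → refl ; sub = λ _ _ () }

  size-firstEdge : size firstEdge ≤ 1
  size-firstEdge = ≤-trans (size-spanned H firstPair firstPair⊆adj) (pairCount-single (2 + M) 0 1)

  size-pathEdges : size pathEdges ≤ suc M
  size-pathEdges = ≤-trans (size-spanned H successor successor⊆adj) (pairCount-successor (suc M))

  size-allEdges : size allEdges ≤ 3 + M
  size-allEdges = begin
      size allEdges
        ≤⟨ relSize-mono {R′ = λ h h′ → thetaRaw k ℓ h h′ ∨ thetaRaw k ℓ h′ h} (λ h h′ → proj₂ ∘ ∧-true {not (eqF h h′)}) ⟩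
      relSize (λ h h′ → thetaRaw k ℓ h h′ ∨ thetaRaw k ℓ h′ h)
        ≤⟨ relSize-symmetrise (thetaRaw k ℓ) ⟩
      pairCount (thetaRaw k ℓ)
        ≤⟨ ≤-trans (pairCount-∨ successor (λ h h′ → toLast h h′ ∨ toL h h′))
                   (+-monoʳ-≤ (pairCount successor) (pairCount-∨ toLast toL)) ⟩
      pairCount successor
        + (pairCount toLast + pairCount toL)
        ≤⟨ +-mono-≤ (pairCount-successor (suc M)) (+-mono-≤ (pairCount-single (2 + M) 0 (suc M)) (pairCount-single (2 + M) 0 L)) ⟩
      suc M + 2
        ≡⟨ +-comm (suc M) 2 ⟩
      3 + M ∎
    where
    open ≤-Reasoning
    open Counting (n H)
    toLast toL : Vertex → Vertex → Bool
    toLast h h′ = (toℕ h ≡ᵇ 0) ∧ (toℕ h′ ≡ᵇ suc M)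
    toL h h′ = (toℕ h ≡ᵇ 0) ∧ (toℕ h′ ≡ᵇ L)

  size-noEdges : size noEdges ≡ 0
  size-noEdges = trans (sumFin-cong (n H) λ h → sumFin-cong (n H) λ h′ → cong b2n (Bool.∧-zeroʳ (toℕ h <ᵇ toℕ h′)))
                       (trans (sumFin-cong (n H) λ _ → sumFin-zero (n H)) (sumFin-zero (n H)))

  module Construction (G : Graph) (r′ : ℕ) (A B C : EdgeSet G) where
    open Product G H

    private
      module BG = Bootstrap G
      module BH = Bootstrap H
      module BP = Bootstrap P

    δ : Fin (n G) → ℕ
    δ g = degIn (adj G) g

    layerSeed : Vertex → EdgeSet G
    layerSeed h = layerChoice M (toℕ h) A B C

    layerSeed-middle : ∀ h → 2 ≤ toℕ h → toℕ h ≤ M → layerSeed h ≡ B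
    layerSeed-middle h = layerChoice-middle M (toℕ h)

    fiberSeed : ℕ → EdgeSet H
    fiberSeed d = degreeChoice r′ d firstEdge pathEdges allEdges noEdges

    fiberSeed-above : ∀ {d} → suc (suc r′) ≤ d → fiberSeed d ≡ noEdges
    fiberSeed-above = degreeChoice-above r′

    fiberSeed-r-1 : ∀ {d} → d ≡ suc r′ → fiberSeed d ≡ firstEdge
    fiberSeed-r-1 = degreeChoice-r-1 r′

    fiberSeed-r-2 : ∀ {d} → d ≡ r′ → fiberSeed d ≡ pathEdges
    fiberSeed-r-2 = degreeChoice-r-2 r′

    fiberSeed-below : ∀ {d} → d < r′ → fiberSeed d ≡ allEdges
    fiberSeed-below = degreeChoice-below r′

    S : EdgeSet P
    S = seed layerSeed (fiberSeed ∘ δ)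

    fiberCost : ℕ → ℕ
    fiberCost d = b2n (d ≡ᵇ suc r′) + (suc M * b2n (d ≡ᵇ r′) + (3 + M) * sumBelow r′ (λ t → b2n (d ≡ᵇ t)))

    size-fiberSeed : ∀ d → size (fiberSeed d) ≤ fiberCost d
    size-fiberSeed d with degreeCase r′ d
    ... | above 2+r′≤d rewrite fiberSeed-above 2+r′≤d | size-noEdges = z≤n
    ... | at-r-1 refl rewrite fiberSeed-r-1 refl | ≡ᵇ-refl r′ =
      ≤-trans size-firstEdge (m≤m+n 1 _)
    ... | at-r-2 refl rewrite fiberSeed-r-2 refl | ≡ᵇ-≢ (<⇒≢ (n<1+n r′)) | ≡ᵇ-refl r′ =
      ≤-trans size-pathEdges (≤-trans (≤-reflexive (sym (*-identityʳ (suc M)))) (m≤m+n _ _))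
    ... | below d<r′ rewrite fiberSeed-below d<r′ =
      ≤-trans size-allEdges (≤-trans (≤-trans (≤-reflexive (sym (*-identityʳ (3 + M)))) (*-monoʳ-≤ (3 + M) (sumBelow-hit d<r′)))
                                     (≤-trans (m≤n+m _ (suc M * b2n (d ≡ᵇ r′))) (m≤n+m _ (b2n (d ≡ᵇ suc r′)))))

    size-S : size S ≤ size A + (M ∸ 1) * size B + 2 * size C + dcount G (suc r′)
                      + suc M * dcount G r′ + (3 + M) * sumBelow r′ (dcount G)
    size-S = begin
        size S
          ≤⟨ size-seed layerSeed (fiberSeed ∘ δ) ⟩
        sumFin (n H) (λ h → size (layerSeed h)) + sumFin (n G) (λ g → size (fiberSeed (δ g)))
          ≡⟨ cong (_+ sumFin (n G) (λ g → size (fiberSeed (δ g))))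
                  (trans (sumFin-cong (n H) λ h → layerChoice-map size M (toℕ h) A B C)
                         (sumFin-toℕ (n H) λ i → layerChoice M i (size A) (size B) (size C))) ⟩
        sumBelow (2 + M) (λ i → layerChoice M i (size A) (size B) (size C)) + sumFin (n G) (λ g → size (fiberSeed (δ g)))
          ≤⟨ +-mono-≤ (sumBelow-layerChoice M (size A) (size B) (size C) 1≤M)
                      (sumFin-mono (n G) λ g → size-fiberSeed (δ g)) ⟩
        size A + (M ∸ 1) * size B + 2 * size C + sumFin (n G) (fiberCost ∘ δ)
          ≡⟨ cong (size A + (M ∸ 1) * size B + 2 * size C +_) sumFin-fiberCost ⟩
        size A + (M ∸ 1) * size B + 2 * size C
          + (dcount G (suc r′) + (suc M * dcount G r′ + (3 + M) * sumBelow r′ (dcount G)))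
          ≡⟨ +-assoc-4 (size A + (M ∸ 1) * size B + 2 * size C) (dcount G (suc r′)) _ _ ⟩
        size A + (M ∸ 1) * size B + 2 * size C + dcount G (suc r′)
          + suc M * dcount G r′ + (3 + M) * sumBelow r′ (dcount G) ∎
      where
      open ≤-Reasoning
      +-assoc-4 : ∀ w x y z → w + (x + (y + z)) ≡ w + x + y + z
      +-assoc-4 w x y z = trans (sym (+-assoc w x (y + z))) (sym (+-assoc (w + x) y z))
      indicator : ℕ → Fin (n G) → ℕ
      indicator t g = b2n (δ g ≡ᵇ t)
      sumFin-fiberCost : sumFin (n G) (fiberCost ∘ δ)
                         ≡ dcount G (suc r′) + (suc M * dcount G r′ + (3 + M) * sumBelow r′ (dcount G))
      sumFin-fiberCost =
        trans (sumFin-+ (n G) (indicator (suc r′)) _)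
          (cong (dcount G (suc r′) +_)
            (trans (sumFin-+ (n G) (λ g → suc M * indicator r′ g) _)
              (cong₂ _+_ (sumFin-*ˡ (n G) (suc M) (indicator r′))
                (trans (sumFin-*ˡ (n G) (3 + M) _)
                       (cong ((3 + M) *_) (sumFin-sumBelow (n G) r′ λ g t → indicator t g))))))

    module Percolation (pA : Percolating G (2 + r′) A) (pB : Percolating G (suc r′) B) (pC : Percolating G r′ C)
                       (W : BP.Rel) (S⊆W : mem S BP.⊆ W)
                       (W⊆P : W BP.⊆ adj P) (closed : BP.Closed (2 + r′) W) where
      open ClosedSet (2 + r′) W W⊆P closed

      layerSeeded : ∀ {h X} → layerSeed h ≡ X → mem X BG.⊆ layer h
      layerSeeded {h} refl = seed⊆⇒layer {layerSeed} {fiberSeed ∘ δ} S⊆W h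

      fiberSeeded : ∀ {g X} → fiberSeed (δ g) ≡ X → mem X BH.⊆ fiber g
      fiberSeeded {g} refl = seed⊆⇒fiber {layerSeed} {fiberSeed ∘ δ} S⊆W g

      fdeg : Fin (n G) → Vertex → ℕ
      fdeg g h = degIn (fiber g) h

      1≤fdeg : ∀ {g h h′} → fiber g h h′ ≡ true → 1 ≤ fdeg g h
      1≤fdeg {g} {h} {h′} e = subst (_≤ fdeg g h) (b2n-true e) (term≤sumFin (n H) (b2n ∘ fiber g h) h′)

      2≤fdeg : ∀ {g h x y} → fiber g h x ≡ true → fiber g h y ≡ true → toℕ x ≢ toℕ y → 2 ≤ fdeg g h
      2≤fdeg {g} {h} {x} {y} ex ey x≢y =
        subst (_≤ fdeg g h) (cong₂ _+_ (b2n-true ex) (b2n-true ey))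
              (two-terms≤sumFin (n H) (b2n ∘ fiber g h) (x≢y ∘ cong toℕ))

      reaches-r : ∀ {g h s j} → 2 + r′ ≤ s + j → s ≤ δ g → j ≤ fdeg g h → 2 + r′ ≤ δ g + fdeg g h
      reaches-r r≤s+j s≤δ j≤fdeg = ≤-trans r≤s+j (+-mono-≤ s≤δ j≤fdeg)

      r≤r+0 : 2 + r′ ≤ 2 + r′ + 0
      r≤r+0 = ≤-reflexive (sym (+-identityʳ _))

      r≤r-1+1 : 2 + r′ ≤ suc r′ + 1
      r≤r-1+1 = ≤-reflexive (+-comm 1 (suc r′))

      r≤r-2+2 : 2 + r′ ≤ r′ + 2
      r≤r-2+2 = ≤-reflexive (+-comm 2 r′)

      first-in : ∀ g → δ g ≡ suc r′ → ∀ h h′ → firstPair h h′ ≡ true → fiber g h h′ ≡ true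
      first-in g δ≡ h h′ e = fiberSeeded (fiberSeed-r-1 δ≡) h h′ (∨-introˡ _ e)

      path-in : ∀ g → δ g ≡ r′ → ∀ h h′ → toℕ h′ ≡ suc (toℕ h) → fiber g h h′ ≡ true × fiber g h′ h ≡ true
      path-in g δ≡ h h′ e = seeded h h′ (∨-introˡ _ succ) , seeded h′ h (∨-introʳ (successor h′ h) succ)
        where
        succ : successor h h′ ≡ true
        succ = dec-true (suc (toℕ h) ≟ toℕ h′) (sym e)
        seeded : ∀ u v → mem pathEdges u v ≡ true → fiber g u v ≡ true
        seeded = fiberSeeded (fiberSeed-r-2 δ≡)

      all-in : ∀ g → δ g < r′ → adj H BH.⊆ fiber g
      all-in g δ<r′ = fiberSeeded (fiberSeed-below δ<r′)

      Good : Vertex → Set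
      Good h = LayerFull h × (∀ g → suc r′ ≤ δ g → 1 ≤ fdeg g h)

      good-fires : ∀ {h} → Good h → ∀ g → suc r′ ≤ δ g → ∀ h′ → adj H h h′ ≡ true → fiber g h h′ ≡ true × fiber g h′ h ≡ true
      good-fires (full , edge) g r-1≤δ = fiber-fires g _ full (reaches-r r≤r-1+1 r-1≤δ (edge g r-1≤δ))

      good-spreads : ∀ {h h′} → Good h → adj H h h′ ≡ true → layerSeed h′ ≡ B → Good h′
      good-spreads {h} {h′} good hh′∈H seed≡B =
        layer-full h′ (suc r′) 1 r≤r-1+1 edge B pB (layerSeeded seed≡B) , edge
        where
        edge : ∀ g → suc r′ ≤ δ g → 1 ≤ fdeg g h′
        edge g r-1≤δ = 1≤fdeg (proj₂ (good-fires good g r-1≤δ h′ hh′∈H))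

      good-0 : ∀ {h} → toℕ h ≡ 0 → Good h
      good-0 {h} h≡0 = full , edge
        where
        full : LayerFull h
        full = layer-full h (2 + r′) 0 r≤r+0 (λ _ _ → z≤n) A pA
                 (layerSeeded (cong (λ i → layerChoice M i A B C) h≡0))
        edge : ∀ g → suc r′ ≤ δ g → 1 ≤ fdeg g h
        edge g r-1≤δ with degreeCase r′ (δ g)
        ... | above r≤δ = 1≤fdeg (proj₁ (fiber-fires g h full (reaches-r r≤r+0 r≤δ z≤n) v1
                                          (adj-succ h v1 (trans toℕ-v1 (cong suc (sym h≡0))))))
        ... | at-r-1 δ≡ = 1≤fdeg (first-in g δ≡ h v1 (firstPair-intro h≡0 toℕ-v1))
        ... | at-r-2 δ≡ = ⊥-elim (1+n≰n (subst (suc r′ ≤_) δ≡ r-1≤δ))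
        ... | below δ<r′ = ⊥-elim (1+n≰n (≤-trans r-1≤δ (<⇒≤ δ<r′)))

      good-L : ∀ {h} → toℕ h ≡ L → Good h
      good-L {h} h≡L = good-spreads (good-0 toℕ-v0) (adj-0-L v0 h toℕ-v0 h≡L)
                                    (layerSeed-middle h (subst (2 ≤_) (sym h≡L) (s≤s (s≤s z≤n))) (subst (_≤ M) (sym h≡L) (<⇒≤ L<M)))

      good-below-L : ∀ d {h} → toℕ h + d ≡ L → 2 ≤ toℕ h → Good h
      good-below-L zero {h} h+0≡L _ = good-L (trans (sym (+-identityʳ (toℕ h))) h+0≡L)
      good-below-L (suc d) {h} h+1+d≡L 2≤h =
        good-spreads (good-below-L d {next} (trans (cong (_+ d) toℕ-next) 1+h+d≡L)
                                    (subst (2 ≤_) (sym toℕ-next) (≤-trans 2≤h (n≤1+n _))))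
                     (adj-pred next h toℕ-next) (layerSeed-middle h 2≤h (≤-trans (n≤1+n _) (≤-trans 1+h≤L (<⇒≤ L<M))))
        where
        1+h+d≡L : suc (toℕ h) + d ≡ L
        1+h+d≡L = trans (sym (+-suc (toℕ h) d)) h+1+d≡L
        1+h≤L : suc (toℕ h) ≤ L
        1+h≤L = subst (suc (toℕ h) ≤_) 1+h+d≡L (m≤m+n _ d)
        next-bound : suc (toℕ h) ≤ suc M
        next-bound = ≤-trans 1+h≤L (≤-trans (<⇒≤ L<M) (n≤1+n M))
        next : Vertex
        next = vertex (suc (toℕ h)) next-bound
        toℕ-next : toℕ next ≡ suc (toℕ h)
        toℕ-next = toℕ-vertex (suc (toℕ h)) next-bound

      good-above-L : ∀ d {h} → L + d ≡ toℕ h → toℕ h ≤ M → Good h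
      good-above-L zero {h} L+0≡h _ = good-L (trans (sym L+0≡h) (+-identityʳ L))
      good-above-L (suc d) {h} L+1+d≡h h≤M =
        good-spreads (good-above-L d {prev} (sym toℕ-prev) (subst (_≤ M) (sym toℕ-prev) (≤-trans (n≤1+n _) 1+L+d≤M)))
                     (adj-succ prev h (trans (sym 1+L+d≡h) (cong suc (sym toℕ-prev))))
                     (layerSeed-middle h (subst (2 ≤_) 1+L+d≡h (s≤s (≤-trans (s≤s z≤n) (m≤m+n L d)))) h≤M)
        where
        1+L+d≡h : suc (L + d) ≡ toℕ h
        1+L+d≡h = trans (sym (+-suc L d)) L+1+d≡h
        1+L+d≤M : suc (L + d) ≤ M
        1+L+d≤M = subst (_≤ M) (sym 1+L+d≡h) h≤M
        prev-bound : L + d ≤ suc M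
        prev-bound = ≤-trans (n≤1+n _) (≤-trans 1+L+d≤M (n≤1+n M))
        prev : Vertex
        prev = vertex (L + d) prev-bound
        toℕ-prev : toℕ prev ≡ L + d
        toℕ-prev = toℕ-vertex (L + d) prev-bound

      good-middle : ∀ {h} → 2 ≤ toℕ h → toℕ h ≤ M → Good h
      good-middle {h} 2≤h h≤M with toℕ h ≤? L
      ... | yes h≤L = good-below-L (L ∸ toℕ h) (m+[n∸m]≡n h≤L) 2≤h
      ... | no h≰L = good-above-L (toℕ h ∸ L) (m+[n∸m]≡n (<⇒≤ (≰⇒> h≰L))) h≤M

      C-layer-full : ∀ {h x y} → layerSeed h ≡ C → Good x → Good y → adj H x h ≡ true → adj H y h ≡ true →
                     toℕ x ≢ toℕ y → (∀ g → δ g ≡ r′ → 2 ≤ fdeg g h) → LayerFull h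
      C-layer-full {h} seed≡C good-x good-y xh∈H yh∈H x≢y at-r-2-edges =
        layer-full h r′ 2 r≤r-2+2 two-edges C pC (layerSeeded seed≡C)
        where
        from-neighbours : ∀ g → suc r′ ≤ δ g → 2 ≤ fdeg g h
        from-neighbours g r-1≤δ =
          2≤fdeg (proj₂ (good-fires good-x g r-1≤δ h xh∈H)) (proj₂ (good-fires good-y g r-1≤δ h yh∈H)) x≢y
        two-edges : ∀ g → r′ ≤ δ g → 2 ≤ fdeg g h
        two-edges g r-2≤δ with degreeCase r′ (δ g)
        ... | above r≤δ = from-neighbours g (≤-trans (n≤1+n _) r≤δ)
        ... | at-r-1 δ≡ = from-neighbours g (≤-reflexive (sym δ≡))
        ... | at-r-2 δ≡ = at-r-2-edges g δ≡
        ... | below δ<r′ = ⊥-elim (<⇒≱ δ<r′ r-2≤δ)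

      fdeg-path : ∀ g → δ g ≡ r′ → ∀ j {h} → toℕ h ≡ suc j → suc j ≤ M → 2 ≤ fdeg g h
      fdeg-path g δ≡ j {h} h≡1+j 1+j≤M =
        2≤fdeg (proj₂ (path-in g δ≡ prev h (trans h≡1+j (cong suc (sym toℕ-prev)))))
               (proj₁ (path-in g δ≡ h next (trans toℕ-next (cong suc (sym h≡1+j)))))
               (λ e → <⇒≢ (m<n⇒m<1+n (n<1+n j)) (trans (sym toℕ-prev) (trans e toℕ-next)))
        where
        prev-bound : j ≤ suc M
        prev-bound = ≤-trans (n≤1+n j) (≤-trans 1+j≤M (n≤1+n M))
        prev next : Vertex
        prev = vertex j prev-bound
        next = vertex (suc (suc j)) (s≤s 1+j≤M)
        toℕ-prev : toℕ prev ≡ j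
        toℕ-prev = toℕ-vertex j prev-bound
        toℕ-next : toℕ next ≡ suc (suc j)
        toℕ-next = toℕ-vertex (suc (suc j)) (s≤s 1+j≤M)

      -- The edge {0, 1} is seeded and the edge {0, L} is infected from the full layer at L.
      fdeg-0 : ∀ g → δ g ≡ r′ → ∀ {h} → toℕ h ≡ 0 → 2 ≤ fdeg g h
      fdeg-0 g δ≡ {h} h≡0 =
        2≤fdeg (proj₁ (path-in g δ≡ h v1 (trans toℕ-v1 (cong suc (sym h≡0)))))
               (proj₂ (fiber-fires g vL (proj₁ (good-L toℕ-vL))
                         (reaches-r r≤r-2+2 (≤-reflexive (sym δ≡)) (fdeg-path g δ≡ (2 + ℓ′) toℕ-vL (<⇒≤ L<M)))
                         h (trans (Graph.sym H vL h) (adj-0-L h vL h≡0 toℕ-vL))))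
               (λ e → 0≢1+n (suc-injective (trans (sym toℕ-v1) (trans e toℕ-vL))))
        where
        vL-bound : L ≤ suc M
        vL-bound = ≤-trans (<⇒≤ L<M) (n≤1+n M)
        vL : Vertex
        vL = vertex L vL-bound
        toℕ-vL : toℕ vL ≡ L
        toℕ-vL = toℕ-vertex L vL-bound

      layer-1-full : ∀ {h} → toℕ h ≡ 1 → LayerFull h
      layer-1-full {h} h≡1 =
        C-layer-full (cong (λ i → layerChoice M i A B C) h≡1) (good-0 toℕ-v0) (good-middle 2≤v2 v2≤M)
          (adj-succ v0 h (trans h≡1 (cong suc (sym toℕ-v0)))) (adj-pred v2 h (trans toℕ-v2 (cong suc (sym h≡1))))
          (λ e → 0≢1+n (trans (sym toℕ-v0) (trans e toℕ-v2))) (λ g δ≡ → fdeg-path g δ≡ 0 h≡1 1≤M)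
        where
        v2 : Vertex
        v2 = vertex 2 (s≤s 1≤M)
        toℕ-v2 : toℕ v2 ≡ 2
        toℕ-v2 = toℕ-vertex 2 (s≤s 1≤M)
        2≤v2 : 2 ≤ toℕ v2
        2≤v2 = ≤-reflexive (sym toℕ-v2)
        v2≤M : toℕ v2 ≤ M
        v2≤M = subst (_≤ M) (sym toℕ-v2) (≤-trans (s≤s (s≤s z≤n)) (<⇒≤ L<M))

      layer-last-full : ∀ {h} → toℕ h ≡ suc M → LayerFull h
      layer-last-full {h} h≡last =
        C-layer-full (trans (cong (λ i → layerChoice M i A B C) h≡last) (layerChoice-last M {x = A} {B} {C})) (good-0 toℕ-v0)
          (good-middle 2≤vM (≤-reflexive toℕ-vM)) (adj-0-last v0 h toℕ-v0 h≡last) vM-h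
          v0≢vM fired-from-0
        where
        vM : Vertex
        vM = vertex M (n≤1+n M)
        toℕ-vM : toℕ vM ≡ M
        toℕ-vM = toℕ-vertex M (n≤1+n M)
        2≤vM : 2 ≤ toℕ vM
        2≤vM = subst (2 ≤_) (sym toℕ-vM) (≤-trans (s≤s (s≤s z≤n)) (<⇒≤ L<M))
        vM-h : adj H vM h ≡ true
        vM-h = adj-succ vM h (trans h≡last (cong suc (sym toℕ-vM)))
        v0≢vM : toℕ v0 ≢ toℕ vM
        v0≢vM e = <⇒≢ 1≤M (trans (sym toℕ-v0) (trans e toℕ-vM))
        fired-from-0 : ∀ g → δ g ≡ r′ → 2 ≤ fdeg g h
        fired-from-0 g δ≡ =
          2≤fdeg (proj₂ (fiber-fires g v0 (proj₁ (good-0 toℕ-v0)) (reaches-r r≤r-2+2 (≤-reflexive (sym δ≡)) (fdeg-0 g δ≡ toℕ-v0))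
                                     h (adj-0-last v0 h toℕ-v0 h≡last)))
                 (proj₂ (path-in g δ≡ vM h (trans h≡last (cong suc (sym toℕ-vM)))))
                 v0≢vM

      all-layers : ∀ h → LayerFull h
      all-layers h with vertex-cases h
      ... | inj₁ h≡0 = proj₁ (good-0 h≡0)
      ... | inj₂ (inj₁ h≡1) = layer-1-full h≡1
      ... | inj₂ (inj₂ (inj₁ (2≤h , h≤M))) = proj₁ (good-middle 2≤h h≤M)
      ... | inj₂ (inj₂ (inj₂ h≡last)) = layer-last-full h≡last

      fires-at : ∀ {g h s j} → 2 + r′ ≤ s + j → s ≤ δ g → j ≤ fdeg g h →
                 ∀ h′ → adj H h h′ ≡ true → fiber g h h′ ≡ true × fiber g h′ h ≡ true
      fires-at {g} {h} r≤s+j s≤δ j≤fdeg = fiber-fires g h (all-layers h) (reaches-r r≤s+j s≤δ j≤fdeg)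

      fdeg-r-1 : ∀ g → δ g ≡ suc r′ → ∀ i {h} → toℕ h ≡ i → 1 ≤ fdeg g h
      fdeg-r-1 g δ≡ zero {h} h≡0 = 1≤fdeg (first-in g δ≡ h v1 (firstPair-intro h≡0 toℕ-v1))
      fdeg-r-1 g δ≡ (suc i) {h} h≡1+i =
        1≤fdeg (proj₂ (fires-at r≤r-1+1 (≤-reflexive (sym δ≡)) (fdeg-r-1 g δ≡ i toℕ-prev) h
                                (adj-succ prev h (trans h≡1+i (cong suc (sym toℕ-prev))))))
        where
        prev-bound : i ≤ suc M
        prev-bound = ≤-trans (n≤1+n i) (s≤s⁻¹ (subst (_< 2 + M) h≡1+i (Fin.toℕ<n h)))
        prev : Vertex
        prev = vertex i prev-bound
        toℕ-prev : toℕ prev ≡ i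
        toℕ-prev = toℕ-vertex i prev-bound

      fdeg-r-2 : ∀ g → δ g ≡ r′ → ∀ {h} → toℕ h ≤ M → 2 ≤ fdeg g h
      fdeg-r-2 g δ≡ {h} h≤M with toℕ h in h≡
      ... | zero = fdeg-0 g δ≡ h≡
      ... | suc j = fdeg-path g δ≡ j h≡ h≤M

      all-fibers : ∀ g → adj H BH.⊆ fiber g
      all-fibers g h h′ hh′∈H with degreeCase r′ (δ g)
      ... | above r≤δ = proj₁ (fires-at r≤r+0 r≤δ z≤n h′ hh′∈H)
      ... | at-r-1 δ≡ = proj₁ (fires-at r≤r-1+1 (≤-reflexive (sym δ≡)) (fdeg-r-1 g δ≡ (toℕ h) refl) h′ hh′∈H)
      ... | below δ<r′ = all-in g δ<r′ h h′ hh′∈H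
      ... | at-r-2 δ≡ with toℕ h ≤? M
      ...   | yes h≤M = proj₁ (fires-at r≤r-2+2 (≤-reflexive (sym δ≡)) (fdeg-r-2 g δ≡ h≤M) h′ hh′∈H)
      ...   | no h≰M = proj₂ (fires-at r≤r-2+2 (≤-reflexive (sym δ≡)) (fdeg-r-2 g δ≡ h′≤M) h (trans (Graph.sym H h′ h) hh′∈H))
        where
        h≡last : toℕ h ≡ suc M
        h≡last = ≤-antisym (s≤s⁻¹ (Fin.toℕ<n h)) (≰⇒> h≰M)
        h′≤M : toℕ h′ ≤ M
        h′≤M = s≤s⁻¹ (≤∧≢⇒< (s≤s⁻¹ (Fin.toℕ<n h′)) λ e → adj⇒≢ h h′ hh′∈H (trans h≡last (sym e)))

      contains-all : adj P BP.⊆ W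
      contains-all = contains-P all-layers all-fibers

    percolates : Percolating G (2 + r′) A → Percolating G (suc r′) B → Percolating G r′ C → Percolating P (2 + r′) S
    percolates pA pB pC =
      BP.T∞ , BP.percolates-if-closed-supersets-full (2 + r′) (mem S) (sub S) (Percolation.contains-all pA pB pC)

proposition4p3 : (r k ℓ : ℕ) → 1 < r → 4 ≤ ℓ → ℓ ≤ k → (G : Graph) →
    (a b c : ℕ) → IsMe G r a → IsMe G (r ∸ 1) b → IsMe G (r ∸ 2) c →
    Σ ℕ λ m → IsMe (G □ theta k ℓ) r m ×
      m ≤ a + (k + ℓ ∸ 5) * b + 2 * c + dcount G (r ∸ 1)
            + (k + ℓ ∸ 3) * dcount G (r ∸ 2)
            + (k + ℓ ∸ 1) * sumBelow (r ∸ 2) (dcount G)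
proposition4p3 (suc (suc r′)) (suc (suc (suc (suc k′)))) (suc (suc (suc (suc ℓ′))))
               (s≤s (s≤s z≤n)) (s≤s (s≤s (s≤s (s≤s z≤n)))) (s≤s (s≤s (s≤s (s≤s _)))) G _ _ _
               ((A , pA , refl) , _) ((B , pB , refl) , _) ((C , pC , refl) , _) =
  Minimum.minimum-exists (G □ H) (2 + r′) S (percolates pA pB pC) size-S
  where
  open Theta k′ ℓ′
  open Construction G r′ A B C
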